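{- Let $M=(E,\rho)$ be a binary simple $(n,k,d)$-matroid with no isthmuses. If $\mathcal{Z}(M)$ has height 3 and $k\geq 5$, then $\eta(E)=2$ and $d=2$.
   Context: A matroid is binary if representable over $\mathbb{F}_2$; simple means no loops and no parallel elements; an isthmus is an element $e$ with $\rho(E-e)<\rho(E)$. $\eta(X)=|X|-\rho(X)$. An $(n,k,d)$-matroid has $|E|=n$, $\rho(E)=k$ and minimum distance $d=\min\{|X|:X\subseteq E,\ \rho(E-X)<\rho(E)\}$. $\mathcal{Z}(M)$ is the lattice (under inclusion) of cyclic flats, i.e. sets $X$ with $\mathrm{cl}(X)=X$ and $\mathrm{cyc}(X)=X$, where $\mathrm{cl}(X)=\{e:\rho(X\cup e)=\rho(X)\}$ and $\mathrm{cyc}(X)=\{e\in X:\rho(X-e)=\rho(X)\}$. "Height 3" means the longest chains in $\mathcal{Z}(M)$ consist of three elements $0_{\mathcal{Z}}\subsetneq Z\subsetneq 1_{\mathcal{Z}}$. -}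

module Defs where

open import Data.Nat using (ℕ; zero; suc; _+_; _∸_; _≤_; _<_)
open import Data.Bool using (Bool; true; false; _xor_; if_then_else_)
open import Data.Vec using (Vec; []; _∷_; replicate; zipWith)
open import Data.Fin using (Fin) renaming (zero to fzero; suc to fsuc)
open import Data.Fin.Subset using (Subset; _∈_; _⊆_; _⊂_; _∪_; _∩_; _─_; _-_; ⁅_⁆; ⊤; ∣_∣; Nonempty)
open import Data.Product using (Σ; _×_; ∃)
open import Relation.Binary.PropositionalEquality using (_≡_; _≢_)
open import Relation.Nullary using (¬_)

record Matroid (n : ℕ) : Set where
  field
    ρ       : Subset n → ℕ
    ρ-bound : ∀ X → ρ X ≤ ∣ X ∣
    ρ-mono  : ∀ X Y → X ⊆ Y → ρ X ≤ ρ Y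
    ρ-submod : ∀ X Y → ρ (X ∪ Y) + ρ (X ∩ Y) ≤ ρ X + ρ Y

open Matroid public

-- Binary representability.  Vectors of F₂^m are  Vec Bool m  with xor.

sumF2 : ∀ {n m} → (Fin n → Vec Bool m) → Subset n → Vec Bool m
sumF2 {zero}  {m} v []      = replicate m false
sumF2 {suc n} {m} v (b ∷ Z) =
  zipWith _xor_ (if b then v fzero else replicate m false) (sumF2 (λ i → v (fsuc i)) Z)

LinIndep : ∀ {n m} → (Fin n → Vec Bool m) → Subset n → Set
LinIndep {n} {m} v Y = ∀ (Z : Subset n) → Z ⊆ Y → Nonempty Z → sumF2 v Z ≢ replicate m false

IsF2Rank : ∀ {n m} → (Fin n → Vec Bool m) → Subset n → ℕ → Set
IsF2Rank {n} v X r =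
  (Σ (Subset n) λ Y → Y ⊆ X × LinIndep v Y × ∣ Y ∣ ≡ r)
  × (∀ (Y : Subset n) → Y ⊆ X → LinIndep v Y → ∣ Y ∣ ≤ r)

Binary : ∀ {n} → Matroid n → Set
Binary {n} M = Σ ℕ λ m → Σ (Fin n → Vec Bool m) λ v → ∀ X → IsF2Rank v X (ρ M X)

Loopless : ∀ {n} → Matroid n → Set
Loopless M = ∀ e → ρ M ⁅ e ⁆ ≡ 1

NoParallel : ∀ {n} → Matroid n → Set
NoParallel M = ∀ e f → e ≢ f → ρ M (⁅ e ⁆ ∪ ⁅ f ⁆) ≡ 2

Simple : ∀ {n} → Matroid n → Set
Simple M = Loopless M × NoParallel M

IsIsthmus : ∀ {n} → Matroid n → Fin n → Set
IsIsthmus M e = ρ M (⊤ - e) < ρ M ⊤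

NoIsthmus : ∀ {n} → Matroid n → Set
NoIsthmus M = ∀ e → ¬ IsIsthmus M e

η : ∀ {n} → Matroid n → Subset n → ℕ
η M X = ∣ X ∣ ∸ ρ M X

IsMinDistance : ∀ {n} → Matroid n → ℕ → Set
IsMinDistance {n} M d =
  (Σ (Subset n) λ X → ρ M (⊤ ─ X) < ρ M ⊤ × ∣ X ∣ ≡ d)
  × (∀ (X : Subset n) → ρ M (⊤ ─ X) < ρ M ⊤ → d ≤ ∣ X ∣)

IsNKD : ∀ {n} → Matroid n → ℕ → ℕ → Set
IsNKD M k d = ρ M ⊤ ≡ k × IsMinDistance M d

IsFlat : ∀ {n} → Matroid n → Subset n → Set
IsFlat M X = ∀ e → ρ M (X ∪ ⁅ e ⁆) ≡ ρ M X → e ∈ X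

IsCyclic : ∀ {n} → Matroid n → Subset n → Set
IsCyclic M X = ∀ e → e ∈ X → ρ M (X - e) ≡ ρ M X

IsCyclicFlat : ∀ {n} → Matroid n → Subset n → Set
IsCyclicFlat M X = IsFlat M X × IsCyclic M X

Height3 : ∀ {n} → Matroid n → Set
Height3 {n} M =
  (Σ (Subset n) λ Z₀ → Σ (Subset n) λ Z₁ → Σ (Subset n) λ Z₂ →
     IsCyclicFlat M Z₀ × IsCyclicFlat M Z₁ × IsCyclicFlat M Z₂ × Z₀ ⊂ Z₁ × Z₁ ⊂ Z₂)
  × (∀ (Z₀ Z₁ Z₂ Z₃ : Subset n) →
     IsCyclicFlat M Z₀ → IsCyclicFlat M Z₁ → IsCyclicFlat M Z₂ → IsCyclicFlat M Z₃ →
     Z₀ ⊂ Z₁ → Z₁ ⊂ Z₂ → Z₂ ⊂ Z₃ → Data.Empty.⊥)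
  where import Data.Empty

module Submission where

-- Since M is loopless and has no isthmus, ∅ and E are cyclic flats, so height 3 means that the remaining
-- (proper) cyclic flats are pairwise incomparable. Hence a dependent subset of a proper cyclic flat W spans W,
-- and a set outside W that is dependent over W spans M. In a binary representation circuits are zero-sum
-- sets, and the sum of two zero-sum sets is again zero-sum. If a basis B of W missed two elements c, d of W,
-- the fundamental circuits B + c and B + d would sum to the parallel pair {c, d}; so |W| = r(W) + 1.
-- If |E| ≥ r(E) + 3, the same argument applied to a basis B ∪ A₀ of M extending B, with c, d outside W ∪ A₀,
-- shows r(W) = r(E) − 1, hence every circuit has at least r(E) elements. A circuit Y inside B ∪ P, for two
-- elements P outside W, differs from the circuit B + z = W in at most two elements of Y, and counting
-- |Y|, |W| and |Y ⊕ W| then gives r(E) ≤ 4. So r(E) ≥ 5 forces |E| ≤ r(E) + 2. Conversely, W is dependent and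
-- no element outside W is an isthmus, whence |E| ≥ r(E) + 2; then removing two elements outside W lowers the
-- rank, so d ≤ 2, while d ≥ 2 because M has no isthmus.

open import Algebra.Bundles using (CommutativeRing)
open import Data.Bool using (Bool; true; false; _xor_; if_then_else_)
open import Data.Bool.Properties using (T-≡; xor-∧-commutativeRing; xor-same; xor-identityʳ)
import Data.Bool.Properties as Bool
open import Data.Empty using (⊥; ⊥-elim)
open import Data.Fin using (Fin) renaming (zero to fzero; suc to fsuc)
import Data.Fin.Properties as Fin
open import Data.Fin.Subset renaming (⊥ to ∅)
open import Data.Fin.Subset.Induction using (⊂-wellFounded; Acc; acc)
open import Data.Fin.Subset.Properties
open import Data.Nat using (ℕ; zero; suc; _+_; _∸_; _≤_; _<_; _≤ᵇ_; z≤n; s≤s; _≤?_; _<?_)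
open import Data.Nat.Properties
open import Data.Product using (Σ; ∃; _×_; _,_; proj₁; proj₂)
open import Data.Sum using (_⊎_; inj₁; inj₂; [_,_])
open import Data.Vec using (Vec; []; _∷_; here; there; replicate; zipWith; tabulate)
open import Data.Vec.Properties using (≡-dec; lookup∘tabulate; []=⇒lookup; lookup⇒[]=)
open import Function using (Equivalence; _∘_)
open import Relation.Binary.PropositionalEquality hiding ([_])
open import Relation.Nullary using (¬_; yes; no; ¬?)
open import Relation.Nullary.Decidable using (_×-dec_; decidable-stable)
open import Defs

open import Algebra.Properties.CommutativeSemigroup +-commutativeSemigroup
  using () renaming (interchange to +-interchange)
open import Algebra.Properties.CommutativeSemigroup
  (CommutativeRing.+-commutativeSemigroup xor-∧-commutativeRing)
  using () renaming (interchange to xor-interchange)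

private
  variable
    n m : ℕ
    x y : Fin n
    p q : Subset n

x∈p─q⁻ : ∀ (p q : Subset n) → x ∈ p ─ q → x ∈ p × x ∉ q
x∈p─q⁻ (inside ∷ p) (outside ∷ q) here = here , λ ()
x∈p─q⁻ (_ ∷ p) (inside ∷ q) (there x∈p─q) =
  let x∈p , x∉q = x∈p─q⁻ p q x∈p─q in there x∈p , λ { (there x∈q) → x∉q x∈q }
x∈p─q⁻ (_ ∷ p) (outside ∷ q) (there x∈p─q) =
  let x∈p , x∉q = x∈p─q⁻ p q x∈p─q in there x∈p , λ { (there x∈q) → x∉q x∈q }

x∈p-y⁻ : ∀ (p : Subset n) → x ∈ p - y → x ∈ p × x ≢ y
x∈p-y⁻ {y = y} p x∈p-y =
  let x∈p , x∉⁅y⁆ = x∈p─q⁻ p ⁅ y ⁆ x∈p-y in x∈p , x∉⁅y⁆⇒x≢y x∉⁅y⁆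

∪-lub : ∀ {s} → p ⊆ s → q ⊆ s → p ∪ q ⊆ s
∪-lub {p = p} {q} p⊆s q⊆s x∈p∪q with x∈p∪q⁻ p q x∈p∪q
... | inj₁ x∈p = p⊆s x∈p
... | inj₂ x∈q = q⊆s x∈q

∪-mono : ∀ {p′ q′ : Subset n} → p ⊆ p′ → q ⊆ q′ → p ∪ q ⊆ p′ ∪ q′
∪-mono {p′ = p′} {q′} p⊆p′ q⊆q′ =
  ∪-lub (λ x∈p → p⊆p∪q q′ (p⊆p′ x∈p)) (λ x∈q → q⊆p∪q p′ q′ (q⊆q′ x∈q))

x∈p⇒⁅x⁆⊆p : x ∈ p → ⁅ x ⁆ ⊆ p
x∈p⇒⁅x⁆⊆p {x = x} {p} x∈p y∈⁅x⁆ = subst (_∈ p) (sym (x∈⁅y⁆⇒x≡y x y∈⁅x⁆)) x∈p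

infixl 6 _⊕_
_⊕_ : Subset n → Subset n → Subset n
_⊕_ = Data.Vec.zipWith _xor_

x∈p⊕q⁻ : ∀ (p q : Subset n) → x ∈ p ⊕ q → x ∈ p × x ∉ q ⊎ x ∉ p × x ∈ q
x∈p⊕q⁻ (inside ∷ p) (outside ∷ q) here = inj₁ (here , λ ())
x∈p⊕q⁻ (outside ∷ p) (inside ∷ q) here = inj₂ ((λ ()) , here)
x∈p⊕q⁻ (_ ∷ p) (_ ∷ q) (there x∈p⊕q) with x∈p⊕q⁻ p q x∈p⊕q
... | inj₁ (x∈p , x∉q) = inj₁ (there x∈p , λ { (there x∈q) → x∉q x∈q })
... | inj₂ (x∉p , x∈q) = inj₂ ((λ { (there x∈p) → x∉p x∈p }) , there x∈q)

x∈p⊕q⁺ˡ : ∀ (p q : Subset n) → x ∈ p → x ∉ q → x ∈ p ⊕ q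
x∈p⊕q⁺ˡ (inside ∷ p) (outside ∷ q) here x∉q = here
x∈p⊕q⁺ˡ (inside ∷ p) (inside ∷ q) here x∉q = ⊥-elim (x∉q here)
x∈p⊕q⁺ˡ (_ ∷ p) (_ ∷ q) (there x∈p) x∉q = there (x∈p⊕q⁺ˡ p q x∈p (λ x∈q → x∉q (there x∈q)))

x∈p⊕q⁺ʳ : ∀ (p q : Subset n) → x ∉ p → x ∈ q → x ∈ p ⊕ q
x∈p⊕q⁺ʳ (outside ∷ p) (inside ∷ q) x∉p here = here
x∈p⊕q⁺ʳ (inside ∷ p) (inside ∷ q) x∉p here = ⊥-elim (x∉p here)
x∈p⊕q⁺ʳ (_ ∷ p) (_ ∷ q) x∉p (there x∈q) = there (x∈p⊕q⁺ʳ p q (λ x∈p → x∉p (there x∈p)) x∈q)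

Disjoint : Subset n → Subset n → Set
Disjoint p q = ∀ {x} → x ∈ p → x ∉ q

p⊆q∧s⊆∁q⇒Disjoint : ∀ {s} → p ⊆ q → s ⊆ ∁ q → Disjoint p s
p⊆q∧s⊆∁q⇒Disjoint p⊆q s⊆∁q x∈p x∈s = x∈∁p⇒x∉p (s⊆∁q x∈s) (p⊆q x∈p)

∣p∪q∣≡∣p∣+∣q∣ : ∀ (p q : Subset n) → Disjoint p q → ∣ p ∪ q ∣ ≡ ∣ p ∣ + ∣ q ∣
∣p∪q∣≡∣p∣+∣q∣ [] [] _ = refl
∣p∪q∣≡∣p∣+∣q∣ (inside ∷ p) (inside ∷ q) p#q = ⊥-elim (p#q here here)
∣p∪q∣≡∣p∣+∣q∣ (inside ∷ p) (outside ∷ q) p#q =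
  cong suc (∣p∪q∣≡∣p∣+∣q∣ p q (λ x∈p x∈q → p#q (there x∈p) (there x∈q)))
∣p∪q∣≡∣p∣+∣q∣ (outside ∷ p) (inside ∷ q) p#q =
  trans (cong suc (∣p∪q∣≡∣p∣+∣q∣ p q (λ x∈p x∈q → p#q (there x∈p) (there x∈q))))
        (sym (+-suc ∣ p ∣ ∣ q ∣))
∣p∪q∣≡∣p∣+∣q∣ (outside ∷ p) (outside ∷ q) p#q =
  ∣p∪q∣≡∣p∣+∣q∣ p q (λ x∈p x∈q → p#q (there x∈p) (there x∈q))

∣p∣≡∣p∩q∣+∣p─q∣ : ∀ (p q : Subset n) → ∣ p ∣ ≡ ∣ p ∩ q ∣ + ∣ p ─ q ∣
∣p∣≡∣p∩q∣+∣p─q∣ [] [] = refl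
∣p∣≡∣p∩q∣+∣p─q∣ (inside ∷ p) (inside ∷ q) = cong suc (∣p∣≡∣p∩q∣+∣p─q∣ p q)
∣p∣≡∣p∩q∣+∣p─q∣ (inside ∷ p) (outside ∷ q) =
  trans (cong suc (∣p∣≡∣p∩q∣+∣p─q∣ p q)) (sym (+-suc _ _))
∣p∣≡∣p∩q∣+∣p─q∣ (outside ∷ p) (inside ∷ q) = ∣p∣≡∣p∩q∣+∣p─q∣ p q
∣p∣≡∣p∩q∣+∣p─q∣ (outside ∷ p) (outside ∷ q) = ∣p∣≡∣p∩q∣+∣p─q∣ p q

∣p∣≤∣q∣+∣p─q∣ : ∀ (p q : Subset n) → ∣ p ∣ ≤ ∣ q ∣ + ∣ p ─ q ∣
∣p∣≤∣q∣+∣p─q∣ p q = ≤-trans (≤-reflexive (∣p∣≡∣p∩q∣+∣p─q∣ p q)) (+-monoˡ-≤ ∣ p ─ q ∣ (∣p∩q∣≤∣q∣ p q))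

∣p⊕q∣≡∣p─q∣+∣q─p∣ : ∀ (p q : Subset n) → ∣ p ⊕ q ∣ ≡ ∣ p ─ q ∣ + ∣ q ─ p ∣
∣p⊕q∣≡∣p─q∣+∣q─p∣ [] [] = refl
∣p⊕q∣≡∣p─q∣+∣q─p∣ (inside ∷ p) (inside ∷ q) = ∣p⊕q∣≡∣p─q∣+∣q─p∣ p q
∣p⊕q∣≡∣p─q∣+∣q─p∣ (inside ∷ p) (outside ∷ q) = cong suc (∣p⊕q∣≡∣p─q∣+∣q─p∣ p q)
∣p⊕q∣≡∣p─q∣+∣q─p∣ (outside ∷ p) (inside ∷ q) =
  trans (cong suc (∣p⊕q∣≡∣p─q∣+∣q─p∣ p q)) (sym (+-suc _ _))
∣p⊕q∣≡∣p─q∣+∣q─p∣ (outside ∷ p) (outside ∷ q) = ∣p⊕q∣≡∣p─q∣+∣q─p∣ p q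

x∈p⇒∣p∣≡1+∣p-x∣ : x ∈ p → ∣ p ∣ ≡ suc ∣ p - x ∣
x∈p⇒∣p∣≡1+∣p-x∣ {p = inside ∷ p} here = cong suc (sym (cong ∣_∣ (p─⊥≡p p)))
x∈p⇒∣p∣≡1+∣p-x∣ {p = inside ∷ p} (there x∈p) = cong suc (x∈p⇒∣p∣≡1+∣p-x∣ x∈p)
x∈p⇒∣p∣≡1+∣p-x∣ {p = outside ∷ p} (there x∈p) = x∈p⇒∣p∣≡1+∣p-x∣ x∈p

x∈p⇒0<∣p∣ : x ∈ p → 0 < ∣ p ∣
x∈p⇒0<∣p∣ x∈p = ≤-trans (s≤s z≤n) (x∈p⇒∣p-x∣<∣p∣ x∈p)

0<∣p∣⇒Nonempty : ∀ (p : Subset n) → 0 < ∣ p ∣ → Nonempty p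
0<∣p∣⇒Nonempty (inside ∷ p) _ = fzero , here
0<∣p∣⇒Nonempty (outside ∷ p) 0<∣p∣ = let x , x∈p = 0<∣p∣⇒Nonempty p 0<∣p∣ in fsuc x , there x∈p

p⊆q∧∣q∣≤∣p∣⇒q⊆p : p ⊆ q → ∣ q ∣ ≤ ∣ p ∣ → q ⊆ p
p⊆q∧∣q∣≤∣p∣⇒q⊆p {p = p} p⊆q ∣q∣≤∣p∣ {x} x∈q with x ∈? p
... | yes x∈p = x∈p
... | no x∉p = ⊥-elim (<⇒≱ (p⊂q⇒∣p∣<∣q∣ (p⊆q , x , x∈q , x∉p)) ∣q∣≤∣p∣)

∣p∪⁅x⁆∣≡1+∣p∣ : ∀ (p : Subset n) → x ∉ p → ∣ p ∪ ⁅ x ⁆ ∣ ≡ suc ∣ p ∣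
∣p∪⁅x⁆∣≡1+∣p∣ {x = x} p x∉p = begin
  ∣ p ∪ ⁅ x ⁆ ∣     ≡⟨ ∣p∪q∣≡∣p∣+∣q∣ p ⁅ x ⁆ p#⁅x⁆ ⟩
  ∣ p ∣ + ∣ ⁅ x ⁆ ∣ ≡⟨ cong (∣ p ∣ +_) (∣⁅x⁆∣≡1 x) ⟩
  ∣ p ∣ + 1         ≡⟨ +-comm ∣ p ∣ 1 ⟩
  suc ∣ p ∣         ∎
  where
  open ≡-Reasoning
  p#⁅x⁆ : Disjoint p ⁅ x ⁆
  p#⁅x⁆ y∈p y∈⁅x⁆ = x∉p (subst (_∈ p) (x∈⁅y⁆⇒x≡y x y∈⁅x⁆) y∈p)

∣⁅x⁆∪⁅y⁆∣≡2 : x ≢ y → ∣ ⁅ x ⁆ ∪ ⁅ y ⁆ ∣ ≡ 2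
∣⁅x⁆∪⁅y⁆∣≡2 {x = x} {y} x≢y =
  trans (∣p∪⁅x⁆∣≡1+∣p∣ ⁅ x ⁆ (λ y∈⁅x⁆ → x≢y (sym (x∈⁅y⁆⇒x≡y x y∈⁅x⁆))))
        (cong suc (∣⁅x⁆∣≡1 x))

∣p∣+∣∁p∣≡n : ∀ (p : Subset n) → ∣ p ∣ + ∣ ∁ p ∣ ≡ n
∣p∣+∣∁p∣≡n p = trans (cong (∣ p ∣ +_) (∣∁p∣≡n∸∣p∣ p)) (m+[n∸m]≡n (∣p∣≤n p))

subset-of-size : ∀ (p : Subset n) j → j ≤ ∣ p ∣ → ∃ λ q → q ⊆ p × ∣ q ∣ ≡ j
subset-of-size {n} p zero _ = ∅ , (λ x∈∅ → ⊥-elim (∉⊥ x∈∅)) , ∣⊥∣≡0 n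
subset-of-size (inside ∷ p) (suc j) (s≤s j≤∣p∣) =
  let q , q⊆p , ∣q∣≡j = subset-of-size p j j≤∣p∣ in inside ∷ q , in⊆in q⊆p , cong suc ∣q∣≡j
subset-of-size (outside ∷ p) (suc j) j<∣p∣ =
  let q , q⊆p , ∣q∣≡j = subset-of-size p (suc j) j<∣p∣ in outside ∷ q , out⊆ q⊆p , ∣q∣≡j

two-distinct : ∀ (p : Subset n) → 2 ≤ ∣ p ∣ →
               Σ (Fin n) λ x → Σ (Fin n) λ y → x ∈ p × y ∈ p × x ≢ y
two-distinct p 2≤∣p∣ with 0<∣p∣⇒Nonempty p (≤-trans (s≤s z≤n) 2≤∣p∣)
... | x , x∈p
  with 0<∣p∣⇒Nonempty (p - x) (≤-pred (≤-trans 2≤∣p∣ (≤-reflexive (x∈p⇒∣p∣≡1+∣p-x∣ x∈p))))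
... | y , y∈p-x = let y∈p , y≢x = x∈p-y⁻ p y∈p-x in x , y , x∈p , y∈p , λ x≡y → y≢x (sym x≡y)

p⊆q⇒p-x⊆q-x : p ⊆ q → p - x ⊆ q - x
p⊆q⇒p-x⊆q-x {p = p} p⊆q y∈p-x =
  let y∈p , y≢x = x∈p-y⁻ p y∈p-x in x∈p∧x≢y⇒x∈p-y (p⊆q y∈p) y≢x

x∉p⇒p⊆p-x : x ∉ p → p ⊆ p - x
x∉p⇒p⊆p-x x∉p y∈p = x∈p∧x≢y⇒x∈p-y y∈p λ { refl → x∉p y∈p }

p⊆q∪⁅x⁆⇒p-x⊆q : ∀ (q : Subset n) → p ⊆ q ∪ ⁅ x ⁆ → p - x ⊆ q
p⊆q∪⁅x⁆⇒p-x⊆q {p = p} {x = x} q p⊆q∪⁅x⁆ y∈p-x with x∈p-y⁻ p y∈p-x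
... | y∈p , y≢x with x∈p∪q⁻ q ⁅ x ⁆ (p⊆q∪⁅x⁆ y∈p)
...   | inj₁ y∈q = y∈q
...   | inj₂ y∈⁅x⁆ = ⊥-elim (y≢x (x∈⁅y⁆⇒x≡y x y∈⁅x⁆))

[p∪⁅x⁆]⊕[p∪⁅y⁆]≡⁅x⁆∪⁅y⁆ : x ∉ p → y ∉ p → x ≢ y →
                           (p ∪ ⁅ x ⁆) ⊕ (p ∪ ⁅ y ⁆) ≡ ⁅ x ⁆ ∪ ⁅ y ⁆
[p∪⁅x⁆]⊕[p∪⁅y⁆]≡⁅x⁆∪⁅y⁆ {x = x} {p} {y} x∉p y∉p x≢y =
  ⊆-antisym ⊆⁅x⁆∪⁅y⁆ ⁅x⁆∪⁅y⁆⊆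
  where
  ⊆⁅x⁆∪⁅y⁆ : (p ∪ ⁅ x ⁆) ⊕ (p ∪ ⁅ y ⁆) ⊆ ⁅ x ⁆ ∪ ⁅ y ⁆
  ⊆⁅x⁆∪⁅y⁆ z∈ with x∈p⊕q⁻ (p ∪ ⁅ x ⁆) (p ∪ ⁅ y ⁆) z∈
  ... | inj₁ (z∈p∪⁅x⁆ , z∉p∪⁅y⁆) with x∈p∪q⁻ p ⁅ x ⁆ z∈p∪⁅x⁆
  ...   | inj₁ z∈p = ⊥-elim (z∉p∪⁅y⁆ (p⊆p∪q ⁅ y ⁆ z∈p))
  ...   | inj₂ z∈⁅x⁆ = p⊆p∪q ⁅ y ⁆ z∈⁅x⁆
  ⊆⁅x⁆∪⁅y⁆ z∈ | inj₂ (z∉p∪⁅x⁆ , z∈p∪⁅y⁆) with x∈p∪q⁻ p ⁅ y ⁆ z∈p∪⁅y⁆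
  ...   | inj₁ z∈p = ⊥-elim (z∉p∪⁅x⁆ (p⊆p∪q ⁅ x ⁆ z∈p))
  ...   | inj₂ z∈⁅y⁆ = q⊆p∪q ⁅ x ⁆ ⁅ y ⁆ z∈⁅y⁆
  ∉p∪⁅⁆ : ∀ {u w} → u ∉ p → u ≢ w → u ∉ p ∪ ⁅ w ⁆
  ∉p∪⁅⁆ {u} {w} u∉p u≢w u∈ with x∈p∪q⁻ p ⁅ w ⁆ u∈
  ... | inj₁ u∈p = u∉p u∈p
  ... | inj₂ u∈⁅w⁆ = u≢w (x∈⁅y⁆⇒x≡y w u∈⁅w⁆)
  ⁅x⁆∪⁅y⁆⊆ : ⁅ x ⁆ ∪ ⁅ y ⁆ ⊆ (p ∪ ⁅ x ⁆) ⊕ (p ∪ ⁅ y ⁆)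
  ⁅x⁆∪⁅y⁆⊆ z∈ with x∈p∪q⁻ ⁅ x ⁆ ⁅ y ⁆ z∈
  ... | inj₁ z∈⁅x⁆ rewrite x∈⁅y⁆⇒x≡y x z∈⁅x⁆ =
    x∈p⊕q⁺ˡ (p ∪ ⁅ x ⁆) (p ∪ ⁅ y ⁆) (q⊆p∪q p ⁅ x ⁆ (x∈⁅x⁆ x)) (∉p∪⁅⁆ x∉p x≢y)
  ... | inj₂ z∈⁅y⁆ rewrite x∈⁅y⁆⇒x≡y y z∈⁅y⁆ =
    x∈p⊕q⁺ʳ (p ∪ ⁅ x ⁆) (p ∪ ⁅ y ⁆)
      (∉p∪⁅⁆ y∉p (λ y≡x → x≢y (sym y≡x))) (q⊆p∪q p ⁅ y ⁆ (x∈⁅x⁆ y))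

q⊆s⇒p─s⊆p─q : ∀ {s} → q ⊆ s → p ─ s ⊆ p ─ q
q⊆s⇒p─s⊆p─q {q = q} {p = p} {s} q⊆s x∈p─s =
  let x∈p , x∉s = x∈p─q⁻ p s x∈p─s in x∈p∧x∉q⇒x∈p─q x∈p (λ x∈q → x∉s (q⊆s x∈q))

x∈p∧∣p∣≤1⇒p⊆⁅x⁆ : x ∈ p → ∣ p ∣ ≤ 1 → p ⊆ ⁅ x ⁆
x∈p∧∣p∣≤1⇒p⊆⁅x⁆ {x = x} {p = p} x∈p ∣p∣≤1 {y} y∈p with y Fin.≟ x
... | yes refl = x∈⁅x⁆ y
... | no y≢x = ⊥-elim (<⇒≱ (s≤s (x∈p⇒0<∣p∣ (x∈p∧x≢y⇒x∈p-y y∈p y≢x)))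
                          (≤-trans (≤-reflexive (sym (x∈p⇒∣p∣≡1+∣p-x∣ x∈p))) ∣p∣≤1))

⊤─p⊆q∪[∁q─p] : ∀ (p q : Subset n) → ⊤ ─ p ⊆ q ∪ (∁ q ─ p)
⊤─p⊆q∪[∁q─p] p q {x} x∈⊤─p with x ∈? q
... | yes x∈q = p⊆p∪q (∁ q ─ p) x∈q
... | no x∉q =
  q⊆p∪q q (∁ q ─ p) (x∈p∧x∉q⇒x∈p─q (x∉p⇒x∈∁p x∉q) (proj₂ (x∈p─q⁻ ⊤ p x∈⊤─p)))

p⊆q⇒∣q∣≡∣p∣+∣q─p∣ : p ⊆ q → ∣ q ∣ ≡ ∣ p ∣ + ∣ q ─ p ∣
p⊆q⇒∣q∣≡∣p∣+∣q─p∣ {p = p} {q} p⊆q =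
  trans (∣p∣≡∣p∩q∣+∣p─q∣ q p) (cong (λ s → ∣ s ∣ + ∣ q ─ p ∣) q∩p≡p)
  where
  q∩p≡p : q ∩ p ≡ p
  q∩p≡p = ⊆-antisym (p∩q⊆q q p) (λ x∈p → x∈p∩q⁺ (p⊆q x∈p , x∈p))

p⊆[q∪s]∪⁅x⁆⇒p-x⊆q∪[s∩p] : ∀ (q s : Subset n) → p ⊆ (q ∪ s) ∪ ⁅ x ⁆ →
                           p - x ⊆ q ∪ (s ∩ p)
p⊆[q∪s]∪⁅x⁆⇒p-x⊆q∪[s∩p] {p = p} q s p⊆ y∈p-x
  with x∈p∪q⁻ q s (p⊆q∪⁅x⁆⇒p-x⊆q (q ∪ s) p⊆ y∈p-x)
... | inj₁ y∈q = p⊆p∪q (s ∩ p) y∈q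
... | inj₂ y∈s = q⊆p∪q q (s ∩ p) (x∈p∩q⁺ (y∈s , proj₁ (x∈p-y⁻ p y∈p-x)))

⊕-fundamental⊆ : ∀ {p₁ p₂ s a : Subset n} →
                 p₁ ⊆ (s ∪ a) ∪ ⁅ x ⁆ → p₂ ⊆ (s ∪ a) ∪ ⁅ y ⁆ →
                 a ⊆ p₁ → a ⊆ p₂ → p₁ ⊕ p₂ - x ⊆ s ∪ ⁅ y ⁆
⊕-fundamental⊆ {x = x} {y = y} {p₁} {p₂} {s} {a} p₁⊆ p₂⊆ a⊆p₁ a⊆p₂ {z} z∈
  with x∈p-y⁻ (p₁ ⊕ p₂) z∈
... | z∈p₁⊕p₂ , z≢x with x∈p⊕q⁻ p₁ p₂ z∈p₁⊕p₂
...   | inj₁ (z∈p₁ , z∉p₂)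
  with x∈p∪q⁻ s a (p⊆q∪⁅x⁆⇒p-x⊆q (s ∪ a) p₁⊆ (x∈p∧x≢y⇒x∈p-y z∈p₁ z≢x))
...     | inj₁ z∈s = p⊆p∪q ⁅ y ⁆ z∈s
...     | inj₂ z∈a = ⊥-elim (z∉p₂ (a⊆p₂ z∈a))
⊕-fundamental⊆ {x = x} {y = y} {p₁} {p₂} {s} {a} p₁⊆ p₂⊆ a⊆p₁ a⊆p₂ {z} z∈
  | z∈p₁⊕p₂ , z≢x | inj₂ (z∉p₁ , z∈p₂) with x∈p∪q⁻ (s ∪ a) ⁅ y ⁆ (p₂⊆ z∈p₂)
...     | inj₂ z∈⁅y⁆ = q⊆p∪q s ⁅ y ⁆ z∈⁅y⁆
...     | inj₁ z∈s∪a with x∈p∪q⁻ s a z∈s∪a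
...       | inj₁ z∈s = p⊆p∪q ⁅ y ⁆ z∈s
...       | inj₂ z∈a = ⊥-elim (z∉p₁ (a⊆p₁ z∈a))

≤-double-count : ∀ {k a b c} → k ≤ a + b → k ≤ b + c → a + c ≤ k → k ≤ b + b
≤-double-count {k} {a} {b} {c} k≤a+b k≤b+c a+c≤k = +-cancelˡ-≤ k k (b + b) (begin
  k + k               ≤⟨ +-mono-≤ k≤a+b k≤b+c ⟩
  (a + b) + (b + c)   ≡⟨ trans (cong ((a + b) +_) (+-comm b c)) (+-interchange a b c b) ⟩
  (a + c) + (b + b)   ≤⟨ +-monoˡ-≤ (b + b) a+c≤k ⟩
  k + (b + b)         ∎)
  where open ≤-Reasoning

infixl 6 _+₂_
_+₂_ : Vec Bool m → Vec Bool m → Vec Bool m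
_+₂_ = zipWith _xor_

0₂ : Vec Bool m
0₂ {m} = replicate m false

+₂-identityˡ : ∀ (a : Vec Bool m) → 0₂ +₂ a ≡ a
+₂-identityˡ [] = refl
+₂-identityˡ (x ∷ a) = cong (x ∷_) (+₂-identityˡ a)

+₂-identityʳ : ∀ (a : Vec Bool m) → a +₂ 0₂ ≡ a
+₂-identityʳ [] = refl
+₂-identityʳ (x ∷ a) = cong₂ _∷_ (xor-identityʳ x) (+₂-identityʳ a)

+₂-self : ∀ (a : Vec Bool m) → a +₂ a ≡ 0₂
+₂-self [] = refl
+₂-self (x ∷ a) = cong₂ _∷_ (xor-same x) (+₂-self a)

+₂-interchange : ∀ (a b c d : Vec Bool m) → (a +₂ b) +₂ (c +₂ d) ≡ (a +₂ c) +₂ (b +₂ d)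
+₂-interchange [] [] [] [] = refl
+₂-interchange (a ∷ as) (b ∷ bs) (c ∷ cs) (d ∷ ds) =
  cong₂ _∷_ (xor-interchange a b c d) (+₂-interchange as bs cs ds)

if-xor-+₂ : ∀ b c (a : Vec Bool m) →
            (if b xor c then a else 0₂) ≡ (if b then a else 0₂) +₂ (if c then a else 0₂)
if-xor-+₂ true  true  a = sym (+₂-self a)
if-xor-+₂ true  false a = sym (+₂-identityʳ a)
if-xor-+₂ false true  a = sym (+₂-identityˡ a)
if-xor-+₂ false false a = sym (+₂-identityˡ 0₂)

sumF2-⊕ : ∀ {n m} (v : Fin n → Vec Bool m) (p q : Subset n) → sumF2 v (p ⊕ q) ≡ sumF2 v p +₂ sumF2 v q
sumF2-⊕ {zero} v [] [] = sym (+₂-identityˡ _)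
sumF2-⊕ {suc n} v (b ∷ p) (c ∷ q) =
  trans (cong₂ _+₂_ (if-xor-+₂ b c (v fzero)) (sumF2-⊕ (λ i → v (fsuc i)) p q)) (+₂-interchange _ _ _ _)

module Rank {n : ℕ} (M : Matroid n) where

  r : Subset n → ℕ
  r = ρ M

  Dependent : Subset n → Set
  Dependent X = r X < ∣ X ∣

  ρ-monotone : ∀ {X Y} → X ⊆ Y → r X ≤ r Y
  ρ-monotone {X} {Y} = ρ-mono M X Y

  ρ-∅ : r ∅ ≡ 0
  ρ-∅ = n≤0⇒n≡0 (≤-trans (ρ-bound M ∅) (≤-reflexive (∣⊥∣≡0 n)))

  ρ-∪-spannedBy : ∀ {D X T} → D ⊆ X → D ⊆ T → r T ≤ r D → r (X ∪ T) ≤ r X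
  ρ-∪-spannedBy {D} {X} {T} D⊆X D⊆T rT≤rD = +-cancelʳ-≤ (r (X ∩ T)) _ _ (begin
    r (X ∪ T) + r (X ∩ T) ≤⟨ ρ-submod M X T ⟩
    r X + r T             ≤⟨ +-monoʳ-≤ (r X) rT≤rD ⟩
    r X + r D             ≤⟨ +-monoʳ-≤ (r X) (ρ-monotone λ x∈D → x∈p∩q⁺ (D⊆X x∈D , D⊆T x∈D)) ⟩
    r X + r (X ∩ T)       ∎)
    where open ≤-Reasoning

  ρ-∪≤ρ+∣∣ : ∀ X A → r (X ∪ A) ≤ r X + ∣ A ∣
  ρ-∪≤ρ+∣∣ X A = begin
    r (X ∪ A)             ≤⟨ m≤m+n (r (X ∪ A)) (r (X ∩ A)) ⟩
    r (X ∪ A) + r (X ∩ A) ≤⟨ ρ-submod M X A ⟩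
    r X + r A             ≤⟨ +-monoʳ-≤ (r X) (ρ-bound M A) ⟩
    r X + ∣ A ∣           ∎
    where open ≤-Reasoning

  ρ-∪⁅⁆≤1+ρ : ∀ X e → r (X ∪ ⁅ e ⁆) ≤ suc (r X)
  ρ-∪⁅⁆≤1+ρ X e = begin
    r (X ∪ ⁅ e ⁆)     ≤⟨ ρ-∪≤ρ+∣∣ X ⁅ e ⁆ ⟩
    r X + ∣ ⁅ e ⁆ ∣   ≡⟨ cong (r X +_) (∣⁅x⁆∣≡1 e) ⟩
    r X + 1           ≡⟨ +-comm (r X) 1 ⟩
    suc (r X)         ∎
    where open ≤-Reasoning

  ρ-∪-replace : ∀ {B X} Y → B ⊆ X → r X ≤ r B → r (X ∪ Y) ≤ r (B ∪ Y)
  ρ-∪-replace {B} {X} Y B⊆X rX≤rB = ≤-trans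
    (ρ-monotone (∪-lub (q⊆p∪q (B ∪ Y) X) (λ y∈Y → p⊆p∪q X (q⊆p∪q B Y y∈Y))))
    (ρ-∪-spannedBy (p⊆p∪q Y) B⊆X rX≤rB)

  ρ-∪-pointwise : ∀ X Y → (∀ {e} → e ∈ Y → r (X ∪ ⁅ e ⁆) ≤ r X) → r (X ∪ Y) ≤ r X
  ρ-∪-pointwise X Y = go Y (⊂-wellFounded Y)
    where
    go : ∀ Y → Acc _⊂_ Y → (∀ {e} → e ∈ Y → r (X ∪ ⁅ e ⁆) ≤ r X) → r (X ∪ Y) ≤ r X
    go Y (acc rec) spans with nonempty? Y
    ... | no Y-empty = ρ-monotone (∪-lub ⊆-refl (λ e∈Y → ⊥-elim (Y-empty (_ , e∈Y))))
    ... | yes (e , e∈Y) = begin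
      r (X ∪ Y)                       ≤⟨ ρ-monotone (∪-lub (p⊆p∪q _ ∘ p⊆p∪q _) split) ⟩
      r ((X ∪ (Y - e)) ∪ (X ∪ ⁅ e ⁆)) ≤⟨ ρ-∪-spannedBy (p⊆p∪q _) (p⊆p∪q _) (spans e∈Y) ⟩
      r (X ∪ (Y - e))                 ≤⟨ go (Y - e) (rec (x∈p⇒p-x⊂p e∈Y))
                                              (λ x∈Y-e → spans (proj₁ (x∈p-y⁻ Y x∈Y-e))) ⟩
      r X                             ∎
      where
      open ≤-Reasoning
      split : Y ⊆ (X ∪ (Y - e)) ∪ (X ∪ ⁅ e ⁆)
      split {x} x∈Y with x Fin.≟ e
      ... | yes refl = q⊆p∪q _ _ (q⊆p∪q X _ (x∈⁅x⁆ x))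
      ... | no x≢e = p⊆p∪q _ (q⊆p∪q X _ (x∈p∧x≢y⇒x∈p-y x∈Y x≢e))

  cl : Subset n → Subset n
  cl X = tabulate (λ e → r (X ∪ ⁅ e ⁆) ≤ᵇ r X)

  ∈cl⁺ : ∀ X {e} → r (X ∪ ⁅ e ⁆) ≤ r X → e ∈ cl X
  ∈cl⁺ X {e} spans =
    lookup⇒[]= e (cl X) (trans (lookup∘tabulate _ e) (Equivalence.to T-≡ (≤⇒≤ᵇ spans)))

  ∈cl⁻ : ∀ X {e} → e ∈ cl X → r (X ∪ ⁅ e ⁆) ≤ r X
  ∈cl⁻ X {e} e∈cl =
    ≤ᵇ⇒≤ _ _ (Equivalence.from T-≡ (trans (sym (lookup∘tabulate _ e)) ([]=⇒lookup e∈cl)))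

  X⊆cl : ∀ X → X ⊆ cl X
  X⊆cl X x∈X = ∈cl⁺ X (ρ-monotone (∪-lub ⊆-refl (x∈p⇒⁅x⁆⊆p x∈X)))

  ρ-cl : ∀ X → r (cl X) ≡ r X
  ρ-cl X = ≤-antisym
    (≤-trans (ρ-monotone (q⊆p∪q X (cl X))) (ρ-∪-pointwise X (cl X) (∈cl⁻ X)))
    (ρ-monotone (X⊆cl X))

  cl-isFlat : ∀ X → IsFlat M (cl X)
  cl-isFlat X e r[cl∪e]≡r[cl] = ∈cl⁺ X (begin
    r (X ∪ ⁅ e ⁆)    ≤⟨ ρ-monotone (∪-mono (X⊆cl X) ⊆-refl) ⟩
    r (cl X ∪ ⁅ e ⁆) ≡⟨ r[cl∪e]≡r[cl] ⟩
    r (cl X)         ≡⟨ ρ-cl X ⟩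
    r X              ∎)
    where open ≤-Reasoning

  cl-isCyclic : ∀ {X} → IsCyclic M X → IsCyclic M (cl X)
  cl-isCyclic {X} X-cyclic e e∈cl = ≤-antisym (ρ-monotone (p─q⊆p (cl X) ⁅ e ⁆)) (begin
    r (cl X)     ≡⟨ ρ-cl X ⟩
    r X          ≤⟨ rX≤r[X-e] ⟩
    r (X - e)    ≤⟨ ρ-monotone (p⊆q⇒p-x⊆q-x (X⊆cl X)) ⟩
    r (cl X - e) ∎)
    where
    open ≤-Reasoning
    rX≤r[X-e] : r X ≤ r (X - e)
    rX≤r[X-e] with e ∈? X
    ... | yes e∈X = ≤-reflexive (sym (X-cyclic e e∈X))
    ... | no e∉X = ρ-monotone (x∉p⇒p⊆p-x e∉X)

  cl-least : ∀ {X W} → X ⊆ W → IsFlat M W → cl X ⊆ W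
  cl-least {X} {W} X⊆W W-flat {e} e∈cl = W-flat e (≤-antisym
    (≤-trans (ρ-monotone (∪-mono ⊆-refl (q⊆p∪q X ⁅ e ⁆)))
             (ρ-∪-spannedBy X⊆W (p⊆p∪q ⁅ e ⁆) (∈cl⁻ X e∈cl)))
    (ρ-monotone (p⊆p∪q ⁅ e ⁆)))

  nonempty-cyclic⇒dependent : ∀ {W} → IsCyclic M W → Nonempty W → Dependent W
  nonempty-cyclic⇒dependent {W} W-cyclic (e , e∈W) = begin-strict
    r W           ≡⟨ sym (W-cyclic e e∈W) ⟩
    r (W - e)     ≤⟨ ρ-bound M (W - e) ⟩
    ∣ W - e ∣     <⟨ n<1+n _ ⟩
    suc ∣ W - e ∣ ≡⟨ sym (x∈p⇒∣p∣≡1+∣p-x∣ e∈W) ⟩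
    ∣ W ∣         ∎
    where open ≤-Reasoning

  dependent∖basis-nonempty : ∀ {W B} → Dependent W → ∣ B ∣ ≡ r W → Nonempty (W ─ B)
  dependent∖basis-nonempty {W} {B} W-dependent ∣B∣≡rW =
    0<∣p∣⇒Nonempty (W ─ B) (+-cancelˡ-< (r W) 0 _ (begin-strict
      r W + 0           ≡⟨ +-identityʳ (r W) ⟩
      r W               <⟨ W-dependent ⟩
      ∣ W ∣             ≤⟨ ∣p∣≤∣q∣+∣p─q∣ W B ⟩
      ∣ B ∣ + ∣ W ─ B ∣ ≡⟨ cong (_+ ∣ W ─ B ∣) ∣B∣≡rW ⟩
      r W + ∣ W ─ B ∣   ∎))
    where open ≤-Reasoning

  flat-∉⇒ρ<ρ∪⁅⁆ : ∀ {W x} → IsFlat M W → x ∉ W → r W < r (W ∪ ⁅ x ⁆)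
  flat-∉⇒ρ<ρ∪⁅⁆ {W} {x} W-flat x∉W =
    ≰⇒> λ r[W∪x]≤rW → x∉W (W-flat x (≤-antisym r[W∪x]≤rW (ρ-monotone (p⊆p∪q ⁅ x ⁆))))

  flat-∉⇒ρ<ρ⊤ : ∀ {W x} → IsFlat M W → x ∉ W → r W < r ⊤
  flat-∉⇒ρ<ρ⊤ W-flat x∉W = ≤-trans (flat-∉⇒ρ<ρ∪⁅⁆ W-flat x∉W) (ρ-monotone ⊆⊤)

  ρ⊤─≤ρ+∣∁─∣ : ∀ P Z → r (⊤ ─ P) ≤ r Z + ∣ ∁ Z ─ P ∣
  ρ⊤─≤ρ+∣∁─∣ P Z = ≤-trans (ρ-monotone (⊤─p⊆q∪[∁q─p] P Z)) (ρ-∪≤ρ+∣∣ Z (∁ Z ─ P))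

  noIsthmus⇒2≤∣∣ : NoIsthmus M → ∀ X → r (⊤ ─ X) < r ⊤ → 2 ≤ ∣ X ∣
  noIsthmus⇒2≤∣∣ noIsthmus X rank-drop with nonempty? X
  ... | no X-empty = ⊥-elim (<-irrefl refl (≤-trans rank-drop
        (ρ-monotone (λ {x} _ → x∈p∧x∉q⇒x∈p─q ∈⊤ (λ x∈X → X-empty (x , x∈X))))))
  ... | yes (e , e∈X) with 2 ≤? ∣ X ∣
  ...   | yes 2≤∣X∣ = 2≤∣X∣
  ...   | no ∣X∣≱2 = ⊥-elim (noIsthmus e (≤-trans (s≤s (ρ-monotone ⊤-e⊆⊤─X)) rank-drop))
    where
    ⊤-e⊆⊤─X : ⊤ - e ⊆ ⊤ ─ X
    ⊤-e⊆⊤─X = q⊆s⇒p─s⊆p─q (x∈p∧∣p∣≤1⇒p⊆⁅x⁆ e∈X (≤-pred (≰⇒> ∣X∣≱2)))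

  noIsthmus⇒ρ⊤≤ρ+∣∁-∣ : NoIsthmus M → ∀ W e → r ⊤ ≤ r W + ∣ ∁ W - e ∣
  noIsthmus⇒ρ⊤≤ρ+∣∁-∣ noIsthmus W e = ≤-trans (≮⇒≥ (noIsthmus e)) (ρ⊤─≤ρ+∣∁─∣ ⁅ e ⁆ W)

  private
    ∪-cyclic : ∀ {Q A} → IsCyclic M Q → Disjoint A Q →
               (∀ {e} → e ∈ A → r (Q ∪ A) ≤ r (Q ∪ A - e)) → IsCyclic M (Q ∪ A)
    ∪-cyclic {Q} {A} Q-cyclic A#Q A-spanned e e∈Q∪A =
      ≤-antisym (ρ-monotone (p─q⊆p (Q ∪ A) ⁅ e ⁆)) (case (x∈p∪q⁻ Q A e∈Q∪A))
      where
      case : e ∈ Q ⊎ e ∈ A → r (Q ∪ A) ≤ r (Q ∪ A - e)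
      case (inj₂ e∈A) = A-spanned e∈A
      case (inj₁ e∈Q) = ≤-trans
        (ρ-∪-replace A (p─q⊆p Q ⁅ e ⁆) (≤-reflexive (sym (Q-cyclic e e∈Q))))
        (ρ-monotone (∪-lub (p⊆q⇒p-x⊆q-x (p⊆p∪q A))
                           (λ x∈A → x∈p∧x≢y⇒x∈p-y (q⊆p∪q Q A x∈A) λ { refl → A#Q x∈A e∈Q })))

  cyclic-extension : ∀ {Q A} → IsCyclic M Q → Disjoint A Q → r (Q ∪ A) < r Q + ∣ A ∣ →
                     ∃ λ A′ → A′ ⊆ A × Nonempty A′ × IsCyclic M (Q ∪ A′)
  cyclic-extension {Q} {A} Q-cyclic = go A (⊂-wellFounded A)
    where
    go : ∀ A → Acc _⊂_ A → Disjoint A Q → r (Q ∪ A) < r Q + ∣ A ∣ →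
         ∃ λ A′ → A′ ⊆ A × Nonempty A′ × IsCyclic M (Q ∪ A′)
    go A (acc rec) A#Q rank-drop
      with Fin.any? (λ e → (e ∈? A) ×-dec (r (Q ∪ A - e) <? r (Q ∪ A)))
    ... | no no-coloop =
      A , ⊆-refl , A-nonempty , ∪-cyclic Q-cyclic A#Q λ e∈A → ≮⇒≥ λ lt → no-coloop (_ , e∈A , lt)
      where
      A-nonempty : Nonempty A
      A-nonempty = 0<∣p∣⇒Nonempty A (+-cancelˡ-< (r Q) 0 ∣ A ∣ (begin-strict
        r Q + 0   ≡⟨ +-identityʳ (r Q) ⟩
        r Q       ≤⟨ ρ-monotone (p⊆p∪q A) ⟩
        r (Q ∪ A) <⟨ rank-drop ⟩
        r Q + ∣ A ∣ ∎))
        where open ≤-Reasoning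
    ... | yes (e , e∈A , coloop) =
      let A′ , A′⊆A-e , A′-nonempty , Q∪A′-cyclic =
            go (A - e) (rec (x∈p⇒p-x⊂p e∈A)) (A#Q ∘ proj₁ ∘ x∈p-y⁻ A) smaller-drop
      in A′ , (λ x∈A′ → proj₁ (x∈p-y⁻ A (A′⊆A-e x∈A′))) , A′-nonempty , Q∪A′-cyclic
      where
      open ≤-Reasoning
      Q∪[A-e]⊆Q∪A-e : Q ∪ (A - e) ⊆ Q ∪ A - e
      Q∪[A-e]⊆Q∪A-e = ∪-lub (λ x∈Q → x∈p∧x≢y⇒x∈p-y (p⊆p∪q A x∈Q) λ { refl → A#Q e∈A x∈Q })
                            (p⊆q⇒p-x⊆q-x (q⊆p∪q Q A))
      smaller-drop : r (Q ∪ (A - e)) < r Q + ∣ A - e ∣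
      smaller-drop = +-cancelˡ-< 1 _ _ (begin-strict
        suc (r (Q ∪ (A - e))) ≤⟨ s≤s (ρ-monotone Q∪[A-e]⊆Q∪A-e) ⟩
        suc (r (Q ∪ A - e))   ≤⟨ coloop ⟩
        r (Q ∪ A)             <⟨ rank-drop ⟩
        r Q + ∣ A ∣           ≡⟨ cong (r Q +_) (x∈p⇒∣p∣≡1+∣p-x∣ e∈A) ⟩
        r Q + suc ∣ A - e ∣   ≡⟨ +-suc (r Q) _ ⟩
        suc (r Q + ∣ A - e ∣) ∎)

  dependent⇒cyclic⊆ : ∀ {A} → Dependent A → ∃ λ C → C ⊆ A × Nonempty C × IsCyclic M C
  dependent⇒cyclic⊆ {A} A-dependent
    with cyclic-extension {∅} {A} (λ _ e∈∅ → ⊥-elim (∉⊥ e∈∅)) (λ _ → ∉⊥)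
           (subst₂ _<_ (cong r (sym (∪-identityˡ A))) (cong (_+ ∣ A ∣) (sym ρ-∅)) A-dependent)
  ... | C , C⊆A , C-nonempty , ∅∪C-cyclic =
    C , C⊆A , C-nonempty , subst (IsCyclic M) (∪-identityˡ C) ∅∪C-cyclic

module BinaryRepresentation {n m : ℕ} (M : Matroid n) (v : Fin n → Vec Bool m)
                            (represents : ∀ X → IsF2Rank v X (ρ M X)) where

  open Rank M

  Independent : Subset n → Set
  Independent = LinIndep v

  ZeroSum : Subset n → Set
  ZeroSum X = sumF2 v X ≡ 0₂

  zeroSum-⊕ : ∀ {X Y} → ZeroSum X → ZeroSum Y → ZeroSum (X ⊕ Y)
  zeroSum-⊕ {X} {Y} ΣX≡0 ΣY≡0 =
    trans (sumF2-⊕ v X Y) (trans (cong₂ _+₂_ ΣX≡0 ΣY≡0) (+₂-identityˡ 0₂))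

  independent-⊆ : ∀ {X Y} → X ⊆ Y → Independent Y → Independent X
  independent-⊆ X⊆Y Y-indep Z Z⊆X = Y-indep Z (λ z∈Z → X⊆Y (Z⊆X z∈Z))

  basis : ∀ X → ∃ λ B → B ⊆ X × Independent B × ∣ B ∣ ≡ r X
  basis X = proj₁ (represents X)

  independent⇒ρ≡∣∣ : ∀ {X} → Independent X → r X ≡ ∣ X ∣
  independent⇒ρ≡∣∣ {X} X-indep = ≤-antisym (ρ-bound M X) (proj₂ (represents X) X ⊆-refl X-indep)

  ∣∣≤ρ⇒independent : ∀ {X} → ∣ X ∣ ≤ r X → Independent X
  ∣∣≤ρ⇒independent {X} ∣X∣≤rX =
    let B , B⊆X , B-indep , ∣B∣≡rX = basis X
    in independent-⊆ (p⊆q∧∣q∣≤∣p∣⇒q⊆p B⊆X (≤-trans ∣X∣≤rX (≤-reflexive (sym ∣B∣≡rX)))) B-indep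

  zeroSum⇒dependent : ∀ {X} → Nonempty X → ZeroSum X → Dependent X
  zeroSum⇒dependent {X} X-nonempty ΣX≡0 =
    ≰⇒> λ ∣X∣≤rX → ∣∣≤ρ⇒independent ∣X∣≤rX X ⊆-refl X-nonempty ΣX≡0

  dependent⇒zeroSum⊆ : ∀ {X} → Dependent X → ∃ λ Z → Z ⊆ X × Nonempty Z × ZeroSum Z
  dependent⇒zeroSum⊆ {X} X-dependent
    with anySubset? (λ Z → (Z ⊆? X) ×-dec (nonempty? Z ×-dec ≡-dec Bool._≟_ (sumF2 v Z) 0₂))
  ... | yes witness = witness
  ... | no none = ⊥-elim (<-irrefl (independent⇒ρ≡∣∣ X-indep) X-dependent)
    where
    X-indep : Independent X
    X-indep Z Z⊆X Z-nonempty ΣZ≡0 = none (Z , Z⊆X , Z-nonempty , ΣZ≡0)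

  circuit⇒zeroSum : ∀ {S} → Dependent S → (∀ {Y} → Y ⊆ S → Dependent Y → S ⊆ Y) → ZeroSum S
  circuit⇒zeroSum S-dependent S-minimal with dependent⇒zeroSum⊆ S-dependent
  ... | Y , Y⊆S , Y-nonempty , ΣY≡0 =
    subst ZeroSum (⊆-antisym Y⊆S (S-minimal Y⊆S (zeroSum⇒dependent Y-nonempty ΣY≡0))) ΣY≡0

  zeroSum⇒ρ≤ρ- : ∀ {Y x} → ZeroSum Y → x ∈ Y → Independent (Y - x) → r Y ≤ r (Y - x)
  zeroSum⇒ρ≤ρ- {Y} {x} ΣY≡0 x∈Y Y-x-indep = ≤-pred (begin-strict
    r Y           <⟨ zeroSum⇒dependent (x , x∈Y) ΣY≡0 ⟩
    ∣ Y ∣         ≡⟨ x∈p⇒∣p∣≡1+∣p-x∣ x∈Y ⟩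
    suc ∣ Y - x ∣ ≡⟨ cong suc (sym (independent⇒ρ≡∣∣ Y-x-indep)) ⟩
    suc (r (Y - x)) ∎)
    where open ≤-Reasoning

  zeroSum-spanned : ∀ {X Y x} → ZeroSum Y → x ∈ Y → Independent (Y - x) → Y - x ⊆ X →
                    r (X ∪ Y) ≤ r X
  zeroSum-spanned ΣY≡0 x∈Y Y-x-indep Y-x⊆X =
    ρ-∪-spannedBy Y-x⊆X (p─q⊆p _ _) (zeroSum⇒ρ≤ρ- ΣY≡0 x∈Y Y-x-indep)

  zeroSum⊆independent∪⁅x⁆⇒x∈ : ∀ {S Y x} → Independent S → Y ⊆ S ∪ ⁅ x ⁆ →
                               Nonempty Y → ZeroSum Y → x ∈ Y
  zeroSum⊆independent∪⁅x⁆⇒x∈ {S} {Y} {x} S-indep Y⊆S∪x Y-nonempty ΣY≡0 with x ∈? Y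
  ... | yes x∈Y = x∈Y
  ... | no x∉Y =
    ⊥-elim (S-indep Y (p⊆q∪⁅x⁆⇒p-x⊆q S Y⊆S∪x ∘ x∉p⇒p⊆p-x x∉Y) Y-nonempty ΣY≡0)

  noParallel⇒¬zeroSum-pair : NoParallel M → ∀ {x y} → x ≢ y → ¬ ZeroSum (⁅ x ⁆ ∪ ⁅ y ⁆)
  noParallel⇒¬zeroSum-pair noParallel {x} {y} x≢y Σ≡0 = <-irrefl
    (trans (noParallel x y x≢y) (sym (∣⁅x⁆∪⁅y⁆∣≡2 x≢y)))
    (zeroSum⇒dependent (x , p⊆p∪q ⁅ y ⁆ (x∈⁅x⁆ x)) Σ≡0)

  basis-∪-independent : ∀ {W B A} → B ⊆ W → Independent B → ∣ B ∣ ≡ r W → A ⊆ ∁ W →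
                        r W + ∣ A ∣ ≤ r (W ∪ A) → Independent (B ∪ A)
  basis-∪-independent {W} {B} {A} B⊆W B-indep ∣B∣≡rW A⊆∁W rW+∣A∣≤r[W∪A] =
    ∣∣≤ρ⇒independent (begin
      ∣ B ∪ A ∣     ≡⟨ ∣p∪q∣≡∣p∣+∣q∣ B A (p⊆q∧s⊆∁q⇒Disjoint B⊆W A⊆∁W) ⟩
      ∣ B ∣ + ∣ A ∣ ≡⟨ cong (_+ ∣ A ∣) ∣B∣≡rW ⟩
      r W + ∣ A ∣   ≤⟨ rW+∣A∣≤r[W∪A] ⟩
      r (W ∪ A)     ≤⟨ ρ-∪-replace A B⊆W rW≤rB ⟩
      r (B ∪ A)     ∎)
    where
    open ≤-Reasoning
    rW≤rB : r W ≤ r B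
    rW≤rB = ≤-reflexive (trans (sym ∣B∣≡rW) (sym (independent⇒ρ≡∣∣ B-indep)))

module Height3Structure {n : ℕ} (M : Matroid n) (loopless : Loopless M) (noIsthmus : NoIsthmus M)
                        (height3 : Height3 M) where

  open Rank M

  Proper : Subset n → Set
  Proper W = IsCyclicFlat M W × Nonempty W × ∃ (_∉ W)

  ∅-isCyclicFlat : IsCyclicFlat M ∅
  ∅-isCyclicFlat = ∅-isFlat , λ _ e∈∅ → ⊥-elim (∉⊥ e∈∅)
    where
    ∅-isFlat : IsFlat M ∅
    ∅-isFlat e r[∅∪e]≡r∅ = ⊥-elim (0≢1+n (begin
      0              ≡⟨ sym ρ-∅ ⟩
      r ∅            ≡⟨ sym r[∅∪e]≡r∅ ⟩
      r (∅ ∪ ⁅ e ⁆)  ≡⟨ cong r (∪-identityˡ ⁅ e ⁆) ⟩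
      r ⁅ e ⁆        ≡⟨ loopless e ⟩
      1              ∎))
      where open ≡-Reasoning

  ⊤-isCyclicFlat : IsCyclicFlat M ⊤
  ⊤-isCyclicFlat = (λ _ _ → ∈⊤) , λ e _ → ≤-antisym (ρ-monotone ⊆⊤) (≮⇒≥ (noIsthmus e))

  proper-exists : ∃ Proper
  proper-exists with proj₁ height3
  ... | _ , W , _ , _ , W-cyclicFlat , _ , (_ , x , x∈W , _) , (_ , y , _ , y∉W) =
    W , W-cyclicFlat , (x , x∈W) , (y , y∉W)

  proper-⊆⇒⊇ : ∀ {W₁ W₂} → Proper W₁ → Proper W₂ → W₁ ⊆ W₂ → W₂ ⊆ W₁
  proper-⊆⇒⊇ {W₁} (W₁-cyclicFlat , (x , x∈W₁) , _) (W₂-cyclicFlat , _ , (y , y∉W₂)) W₁⊆W₂ {w} w∈W₂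
    with w ∈? W₁
  ... | yes w∈W₁ = w∈W₁
  ... | no w∉W₁ = ⊥-elim (proj₂ height3 ∅ _ _ ⊤
      ∅-isCyclicFlat W₁-cyclicFlat W₂-cyclicFlat ⊤-isCyclicFlat
      ((λ x∈∅ → ⊥-elim (∉⊥ x∈∅)) , x , x∈W₁ , ∉⊥) (W₁⊆W₂ , w , w∈W₂ , w∉W₁) (⊆⊤ , y , ∈⊤ , y∉W₂))

  cyclicFlat⇒proper⊎⊤ : ∀ {W} → IsCyclicFlat M W → Nonempty W → Proper W ⊎ ⊤ ⊆ W
  cyclicFlat⇒proper⊎⊤ {W} W-cyclicFlat W-nonempty with Fin.any? (λ x → ¬? (x ∈? W))
  ... | yes x∉W = inj₁ (W-cyclicFlat , W-nonempty , x∉W)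
  ... | no none-outside = inj₂ λ {x} _ → decidable-stable (x ∈? W) (λ x∉W → none-outside (x , x∉W))

  cl-proper⊎⊤ : ∀ {C} → IsCyclic M C → Nonempty C → Proper (cl C) ⊎ ⊤ ⊆ cl C
  cl-proper⊎⊤ {C} C-cyclic (x , x∈C) =
    cyclicFlat⇒proper⊎⊤ (cl-isFlat C , cl-isCyclic C-cyclic) (x , X⊆cl C x∈C)

  proper-dependent : ∀ {W} → Proper W → Dependent W
  proper-dependent ((_ , W-cyclic) , W-nonempty , _) = nonempty-cyclic⇒dependent W-cyclic W-nonempty

  proper-ρ<ρ⊤ : ∀ {W} → Proper W → r W < r ⊤
  proper-ρ<ρ⊤ ((W-flat , _) , _ , (_ , x∉W)) = flat-∉⇒ρ<ρ⊤ W-flat x∉W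

  dependent⇒spanning⊎proper : ∀ {A} → Dependent A → r ⊤ ≤ r A ⊎ ∃ λ W → Proper W × r W ≤ r A
  dependent⇒spanning⊎proper {A} A-dependent with dependent⇒cyclic⊆ A-dependent
  ... | C , C⊆A , C-nonempty , C-cyclic =
    [ (λ clC-proper → inj₂ (cl C , clC-proper , r[clC]≤rA))
    , (λ (⊤⊆clC : ⊤ ⊆ cl C) → inj₁ (≤-trans (ρ-monotone ⊤⊆clC) r[clC]≤rA))
    ] (cl-proper⊎⊤ C-cyclic C-nonempty)
    where
    r[clC]≤rA : r (cl C) ≤ r A
    r[clC]≤rA = ≤-trans (≤-reflexive (ρ-cl C)) (ρ-monotone C⊆A)

  proper⊇dependent⇒ρ≤ : ∀ {W A} → Proper W → A ⊆ W → Dependent A → r W ≤ r A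
  proper⊇dependent⇒ρ≤ {W} {A} W-proper@((W-flat , _) , _ , (y , y∉W)) A⊆W A-dependent
    with dependent⇒cyclic⊆ A-dependent
  ... | C , C⊆A , C-nonempty , C-cyclic
    with cl-proper⊎⊤ C-cyclic C-nonempty | cl-least (λ x∈C → A⊆W (C⊆A x∈C)) W-flat
  ...   | inj₂ ⊤⊆clC | clC⊆W = ⊥-elim (y∉W (clC⊆W (⊤⊆clC ∈⊤)))
  ...   | inj₁ clC-proper | clC⊆W = begin
    r W      ≤⟨ ρ-monotone (proper-⊆⇒⊇ clC-proper W-proper clC⊆W) ⟩
    r (cl C) ≡⟨ ρ-cl C ⟩
    r C      ≤⟨ ρ-monotone C⊆A ⟩
    r A      ∎
    where open ≤-Reasoning

  proper-∪-dependent⇒spanning : ∀ {W A} → Proper W → A ⊆ ∁ W → r (W ∪ A) < r W + ∣ A ∣ →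
                                r ⊤ ≤ r (W ∪ A)
  proper-∪-dependent⇒spanning {W} {A} W-proper@((_ , W-cyclic) , _) A⊆∁W rank-drop
    with cyclic-extension W-cyclic (λ x∈A → x∈∁p⇒x∉p (A⊆∁W x∈A)) rank-drop
  ... | A′ , A′⊆A , (a , a∈A′) , W∪A′-cyclic with cl-proper⊎⊤ W∪A′-cyclic (a , q⊆p∪q W A′ a∈A′)
  ...   | inj₁ cl-proper = ⊥-elim (x∈∁p⇒x∉p (A⊆∁W (A′⊆A a∈A′))
          (proper-⊆⇒⊇ W-proper cl-proper (X⊆cl _ ∘ p⊆p∪q A′) (X⊆cl _ (q⊆p∪q W A′ a∈A′))))
  ...   | inj₂ ⊤⊆cl = begin
    r ⊤            ≤⟨ ρ-monotone ⊤⊆cl ⟩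
    r (cl (W ∪ A′)) ≡⟨ ρ-cl (W ∪ A′) ⟩
    r (W ∪ A′)      ≤⟨ ρ-monotone (∪-mono ⊆-refl A′⊆A) ⟩
    r (W ∪ A)       ∎
    where open ≤-Reasoning

  proper-∪-independent : ∀ {W A} → Proper W → A ⊆ ∁ W → r W + ∣ A ∣ ≤ r ⊤ →
                         r W + ∣ A ∣ ≤ r (W ∪ A)
  proper-∪-independent {W} {A} W-proper A⊆∁W rW+∣A∣≤r⊤ with r (W ∪ A) <? r W + ∣ A ∣
  ... | yes rank-drop =
    ⊥-elim (<⇒≱ rank-drop (≤-trans rW+∣A∣≤r⊤ (proper-∪-dependent⇒spanning W-proper A⊆∁W rank-drop)))
  ... | no ¬rank-drop = ≮⇒≥ ¬rank-drop

  2+ρ⊤≤n : 2 + r ⊤ ≤ n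
  2+ρ⊤≤n with proper-exists
  ... | W , W-proper@(_ , _ , (e , e∉W)) = begin
    2 + r ⊤                      ≤⟨ +-monoʳ-≤ 2 (noIsthmus⇒ρ⊤≤ρ+∣∁-∣ noIsthmus W e) ⟩
    2 + (r W + ∣ ∁ W - e ∣)      ≡⟨ cong suc (sym (+-suc (r W) _)) ⟩
    suc (r W) + suc ∣ ∁ W - e ∣  ≤⟨ +-monoˡ-≤ _ (proper-dependent W-proper) ⟩
    ∣ W ∣ + suc ∣ ∁ W - e ∣      ≡⟨ cong (∣ W ∣ +_) (sym (x∈p⇒∣p∣≡1+∣p-x∣ (x∉p⇒x∈∁p e∉W))) ⟩
    ∣ W ∣ + ∣ ∁ W ∣              ≡⟨ ∣p∣+∣∁p∣≡n W ⟩
    n                            ∎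
    where open ≤-Reasoning

  proper-2≤∣∁∣ : ∀ {W} → Proper W → 2 ≤ ∣ ∁ W ∣
  proper-2≤∣∁∣ {W} W-proper@(_ , _ , (e , e∉W)) = begin
    2                   ≤⟨ s≤s (+-cancelˡ-< (r W) 0 _ (begin-strict
                             r W + 0           ≡⟨ +-identityʳ (r W) ⟩
                             r W               <⟨ proper-ρ<ρ⊤ W-proper ⟩
                             r ⊤               ≤⟨ noIsthmus⇒ρ⊤≤ρ+∣∁-∣ noIsthmus W e ⟩
                             r W + ∣ ∁ W - e ∣ ∎)) ⟩
    suc ∣ ∁ W - e ∣     ≡⟨ sym (x∈p⇒∣p∣≡1+∣p-x∣ (x∉p⇒x∈∁p e∉W)) ⟩
    ∣ ∁ W ∣             ∎
    where open ≤-Reasoning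

  n≤2+ρ⊤⇒cocircuit-pair : n ≤ 2 + r ⊤ → ∃ λ P → r (⊤ ─ P) < r ⊤ × ∣ P ∣ ≡ 2
  n≤2+ρ⊤⇒cocircuit-pair n≤2+r⊤ with proper-exists
  ... | W , W-proper with subset-of-size (∁ W) 2 (proper-2≤∣∁∣ W-proper)
  ...   | P , P⊆∁W , ∣P∣≡2 = P , +-cancelʳ-≤ 2 _ _ (begin
    suc (r (⊤ ─ P)) + 2           ≤⟨ +-monoˡ-≤ 2 (s≤s (ρ⊤─≤ρ+∣∁─∣ P W)) ⟩
    suc (r W + ∣ ∁ W ─ P ∣) + 2   ≡⟨ +-assoc (suc (r W)) _ 2 ⟩
    suc (r W) + (∣ ∁ W ─ P ∣ + 2) ≤⟨ +-monoˡ-≤ _ (proper-dependent W-proper) ⟩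
    ∣ W ∣ + (∣ ∁ W ─ P ∣ + 2)     ≡⟨ cong (∣ W ∣ +_) (+-comm ∣ ∁ W ─ P ∣ 2) ⟩
    ∣ W ∣ + (2 + ∣ ∁ W ─ P ∣)     ≡⟨ cong (λ j → ∣ W ∣ + (j + ∣ ∁ W ─ P ∣)) (sym ∣P∣≡2) ⟩
    ∣ W ∣ + (∣ P ∣ + ∣ ∁ W ─ P ∣) ≡⟨ cong (∣ W ∣ +_) (sym (p⊆q⇒∣q∣≡∣p∣+∣q─p∣ P⊆∁W)) ⟩
    ∣ W ∣ + ∣ ∁ W ∣               ≡⟨ ∣p∣+∣∁p∣≡n W ⟩
    n                             ≤⟨ n≤2+r⊤ ⟩
    2 + r ⊤                       ≡⟨ +-comm 2 (r ⊤) ⟩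
    r ⊤ + 2                       ∎) , ∣P∣≡2
    where open ≤-Reasoning

  n≤2+ρ⊤⇒minDistance≡2 : n ≤ 2 + r ⊤ → ∀ {d} → IsMinDistance M d → d ≡ 2
  n≤2+ρ⊤⇒minDistance≡2 n≤2+r⊤ ((X , X-drop , ∣X∣≡d) , minimal) with n≤2+ρ⊤⇒cocircuit-pair n≤2+r⊤
  ... | P , P-drop , ∣P∣≡2 = ≤-antisym (≤-trans (minimal P P-drop) (≤-reflexive ∣P∣≡2))
                                       (subst (2 ≤_) ∣X∣≡d (noIsthmus⇒2≤∣∣ noIsthmus X X-drop))

module BinaryHeight3 {n m : ℕ} (M : Matroid n) (v : Fin n → Vec Bool m)
                     (represents : ∀ X → IsF2Rank v X (ρ M X))
                     (simple : Simple M) (noIsthmus : NoIsthmus M) (height3 : Height3 M) where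

  open Rank M
  open BinaryRepresentation M v represents
  open Height3Structure M (proj₁ simple) noIsthmus height3

  proper-fundamental : ∀ {W B x} → Proper W → B ⊆ W → ∣ B ∣ ≡ r W → x ∈ W → x ∉ B →
                       ZeroSum (B ∪ ⁅ x ⁆)
  proper-fundamental {W} {B} {x} W-proper B⊆W ∣B∣≡rW x∈W x∉B =
    circuit⇒zeroSum B∪x-dependent B∪x-minimal
    where
    open ≤-Reasoning
    B∪x⊆W : B ∪ ⁅ x ⁆ ⊆ W
    B∪x⊆W = ∪-lub B⊆W (x∈p⇒⁅x⁆⊆p x∈W)
    B∪x-dependent : Dependent (B ∪ ⁅ x ⁆)
    B∪x-dependent = begin-strict
      r (B ∪ ⁅ x ⁆) ≤⟨ ρ-monotone B∪x⊆W ⟩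
      r W           ≡⟨ sym ∣B∣≡rW ⟩
      ∣ B ∣         <⟨ n<1+n ∣ B ∣ ⟩
      suc ∣ B ∣     ≡⟨ sym (∣p∪⁅x⁆∣≡1+∣p∣ B x∉B) ⟩
      ∣ B ∪ ⁅ x ⁆ ∣ ∎
    B∪x-minimal : ∀ {Y} → Y ⊆ B ∪ ⁅ x ⁆ → Dependent Y → B ∪ ⁅ x ⁆ ⊆ Y
    B∪x-minimal {Y} Y⊆B∪x Y-dependent = p⊆q∧∣q∣≤∣p∣⇒q⊆p Y⊆B∪x (begin
      ∣ B ∪ ⁅ x ⁆ ∣ ≡⟨ ∣p∪⁅x⁆∣≡1+∣p∣ B x∉B ⟩
      suc ∣ B ∣     ≡⟨ cong suc ∣B∣≡rW ⟩
      suc (r W)     ≤⟨ s≤s (proper⊇dependent⇒ρ≤ W-proper (B∪x⊆W ∘ Y⊆B∪x) Y-dependent) ⟩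
      suc (r Y)     ≤⟨ Y-dependent ⟩
      ∣ Y ∣         ∎)

  proper-∣∣≤1+ρ : ∀ {W} → Proper W → ∣ W ∣ ≤ suc (r W)
  proper-∣∣≤1+ρ {W} W-proper with basis W | ∣ W ∣ ≤? suc (r W)
  ... | _ | yes ∣W∣≤1+rW = ∣W∣≤1+rW
  ... | B , B⊆W , _ , ∣B∣≡rW | no ∣W∣≰1+rW
    with two-distinct (W ─ B) (+-cancelˡ-≤ (r W) 2 _ (begin
      r W + 2               ≡⟨ +-comm (r W) 2 ⟩
      suc (suc (r W))       ≤⟨ ≰⇒> ∣W∣≰1+rW ⟩
      ∣ W ∣                 ≤⟨ ∣p∣≤∣q∣+∣p─q∣ W B ⟩
      ∣ B ∣ + ∣ W ─ B ∣     ≡⟨ cong (_+ ∣ W ─ B ∣) ∣B∣≡rW ⟩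
      r W + ∣ W ─ B ∣       ∎))
    where open ≤-Reasoning
  ... | c , d , c∈W─B , d∈W─B , c≢d with x∈p─q⁻ W B c∈W─B | x∈p─q⁻ W B d∈W─B
  ...   | c∈W , c∉B | d∈W , d∉B = ⊥-elim (noParallel⇒¬zeroSum-pair (proj₂ simple) c≢d
    (subst ZeroSum ([p∪⁅x⁆]⊕[p∪⁅y⁆]≡⁅x⁆∪⁅y⁆ c∉B d∉B c≢d)
      (zeroSum-⊕ (proper-fundamental W-proper B⊆W ∣B∣≡rW c∈W c∉B)
                 (proper-fundamental W-proper B⊆W ∣B∣≡rW d∈W d∉B))))

  -- The fundamental circuit of any x outside W ∪ A₀ with respect to the basis B ∪ A₀ contains all of A₀
  -- (otherwise a set outside W smaller than A₀ would be dependent over W), so the circuits of two such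
  -- elements c, d sum to a set in which c is spanned by B ∪ ⁅ d ⁆.
  module _ {W} (W-proper : Proper W)
           {B} (B⊆W : B ⊆ W) (B-indep : Independent B) (∣B∣≡rW : ∣ B ∣ ≡ r W)
           {A₀} (A₀⊆∁W : A₀ ⊆ ∁ W) (rW+∣A₀∣≡r⊤ : r W + ∣ A₀ ∣ ≡ r ⊤) where

    private
      ∁W∖A₀⇒∉B∪A₀ : ∀ {x} → x ∈ ∁ W → x ∉ A₀ → x ∉ B ∪ A₀
      ∁W∖A₀⇒∉B∪A₀ {x} x∈∁W x∉A₀ x∈B∪A₀ with x∈p∪q⁻ B A₀ x∈B∪A₀
      ... | inj₁ x∈B = x∈∁p⇒x∉p x∈∁W (B⊆W x∈B)
      ... | inj₂ x∈A₀ = x∉A₀ x∈A₀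

    B∪A₀-independent : Independent (B ∪ A₀)
    B∪A₀-independent = basis-∪-independent B⊆W B-indep ∣B∣≡rW A₀⊆∁W
      (proper-∪-independent W-proper A₀⊆∁W (≤-reflexive rW+∣A₀∣≡r⊤))

    fundamental-⊇A₀ : ∀ {x Y} → x ∈ ∁ W → x ∉ A₀ →
                      Y ⊆ (B ∪ A₀) ∪ ⁅ x ⁆ → ZeroSum Y → x ∈ Y → A₀ ⊆ Y
    fundamental-⊇A₀ {x} {Y} x∈∁W x∉A₀ Y⊆ ΣY≡0 x∈Y with ∣ A₀ ∣ ≤? ∣ A₀ ∩ Y ∣
    ... | yes ∣A₀∣≤∣A₀∩Y∣ = p∩q⊆q A₀ Y ∘ p⊆q∧∣q∣≤∣p∣⇒q⊆p (p∩q⊆p A₀ Y) ∣A₀∣≤∣A₀∩Y∣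
    ... | no ∣A₀∣≰∣A₀∩Y∣ = ⊥-elim (<-irrefl refl (begin-strict
      r W + ∣ A₀ ∩ Y ∣               <⟨ n<1+n _ ⟩
      suc (r W + ∣ A₀ ∩ Y ∣)         ≡⟨ sym (trans (cong (r W +_) ∣A₁∣≡1+∣A₀∩Y∣) (+-suc (r W) _)) ⟩
      r W + ∣ A₁ ∣                   ≤⟨ proper-∪-independent W-proper A₁⊆∁W rW+∣A₁∣≤r⊤ ⟩
      r (W ∪ A₁)                     ≤⟨ ρ-monotone W∪A₁⊆ ⟩
      r ((W ∪ (A₀ ∩ Y)) ∪ Y)         ≤⟨ zeroSum-spanned ΣY≡0 x∈Y Y-x-indep
                                                         (∪-mono B⊆W ⊆-refl ∘ Y-x⊆B∪[A₀∩Y]) ⟩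
      r (W ∪ (A₀ ∩ Y))               ≤⟨ ρ-∪≤ρ+∣∣ W (A₀ ∩ Y) ⟩
      r W + ∣ A₀ ∩ Y ∣               ∎))
      where
      open ≤-Reasoning
      A₁ : Subset n
      A₁ = (A₀ ∩ Y) ∪ ⁅ x ⁆
      ∣A₁∣≡1+∣A₀∩Y∣ : ∣ A₁ ∣ ≡ suc ∣ A₀ ∩ Y ∣
      ∣A₁∣≡1+∣A₀∩Y∣ = ∣p∪⁅x⁆∣≡1+∣p∣ (A₀ ∩ Y) (λ x∈A₀∩Y → x∉A₀ (p∩q⊆p A₀ Y x∈A₀∩Y))
      rW+∣A₁∣≤r⊤ : r W + ∣ A₁ ∣ ≤ r ⊤
      rW+∣A₁∣≤r⊤ = begin
        r W + ∣ A₁ ∣             ≡⟨ cong (r W +_) ∣A₁∣≡1+∣A₀∩Y∣ ⟩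
        r W + suc ∣ A₀ ∩ Y ∣     ≤⟨ +-monoʳ-≤ (r W) (≰⇒> ∣A₀∣≰∣A₀∩Y∣) ⟩
        r W + ∣ A₀ ∣             ≡⟨ rW+∣A₀∣≡r⊤ ⟩
        r ⊤                      ∎
      A₁⊆∁W : A₁ ⊆ ∁ W
      A₁⊆∁W = ∪-lub (λ a∈A₀∩Y → A₀⊆∁W (p∩q⊆p A₀ Y a∈A₀∩Y)) (x∈p⇒⁅x⁆⊆p x∈∁W)
      W∪A₁⊆ : W ∪ A₁ ⊆ (W ∪ (A₀ ∩ Y)) ∪ Y
      W∪A₁⊆ = ∪-lub (p⊆p∪q Y ∘ p⊆p∪q (A₀ ∩ Y))
                    (∪-lub (p⊆p∪q Y ∘ q⊆p∪q W (A₀ ∩ Y)) (q⊆p∪q _ Y ∘ x∈p⇒⁅x⁆⊆p x∈Y))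
      Y-x⊆B∪[A₀∩Y] : Y - x ⊆ B ∪ (A₀ ∩ Y)
      Y-x⊆B∪[A₀∩Y] = p⊆[q∪s]∪⁅x⁆⇒p-x⊆q∪[s∩p] B A₀ Y⊆
      Y-x-indep : Independent (Y - x)
      Y-x-indep = independent-⊆ (p⊆q∪⁅x⁆⇒p-x⊆q (B ∪ A₀) Y⊆) B∪A₀-independent

    fundamental : ∀ {x} → x ∈ ∁ W → x ∉ A₀ →
                  ∃ λ Y → Y ⊆ (B ∪ A₀) ∪ ⁅ x ⁆ × ZeroSum Y × x ∈ Y × A₀ ⊆ Y
    fundamental {x} x∈∁W x∉A₀ with dependent⇒zeroSum⊆ {(B ∪ A₀) ∪ ⁅ x ⁆} (begin-strict
      r ((B ∪ A₀) ∪ ⁅ x ⁆) ≤⟨ ρ-monotone ⊆⊤ ⟩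
      r ⊤                  ≡⟨ sym rW+∣A₀∣≡r⊤ ⟩
      r W + ∣ A₀ ∣         ≡⟨ cong (_+ ∣ A₀ ∣) (sym ∣B∣≡rW) ⟩
      ∣ B ∣ + ∣ A₀ ∣       ≡⟨ sym (∣p∪q∣≡∣p∣+∣q∣ B A₀ (p⊆q∧s⊆∁q⇒Disjoint B⊆W A₀⊆∁W)) ⟩
      ∣ B ∪ A₀ ∣           <⟨ n<1+n _ ⟩
      suc ∣ B ∪ A₀ ∣       ≡⟨ sym (∣p∪⁅x⁆∣≡1+∣p∣ (B ∪ A₀) (∁W∖A₀⇒∉B∪A₀ x∈∁W x∉A₀)) ⟩
      ∣ (B ∪ A₀) ∪ ⁅ x ⁆ ∣ ∎)
      where open ≤-Reasoning
    ... | Y , Y⊆ , Y-nonempty , ΣY≡0 =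
      Y , Y⊆ , ΣY≡0 , x∈Y , fundamental-⊇A₀ x∈∁W x∉A₀ Y⊆ ΣY≡0 x∈Y
      where
      x∈Y : x ∈ Y
      x∈Y = zeroSum⊆independent∪⁅x⁆⇒x∈ B∪A₀-independent Y⊆ Y-nonempty ΣY≡0

    outside-pair-spanned : ∀ {c d} → c ∈ ∁ W → d ∈ ∁ W → c ∉ A₀ → d ∉ A₀ → c ≢ d →
                           r (W ∪ (⁅ c ⁆ ∪ ⁅ d ⁆)) ≤ suc (r W)
    outside-pair-spanned {c} {d} c∈∁W d∈∁W c∉A₀ d∉A₀ c≢d
      with fundamental c∈∁W c∉A₀ | fundamental d∈∁W d∉A₀
    ... | Y₁ , Y₁⊆ , ΣY₁≡0 , c∈Y₁ , A₀⊆Y₁ | Y₂ , Y₂⊆ , ΣY₂≡0 , _ , A₀⊆Y₂ = begin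
      r (W ∪ (⁅ c ⁆ ∪ ⁅ d ⁆))      ≤⟨ ρ-monotone W∪cd⊆ ⟩
      r ((W ∪ ⁅ d ⁆) ∪ (Y₁ ⊕ Y₂))  ≤⟨ zeroSum-spanned (zeroSum-⊕ ΣY₁≡0 ΣY₂≡0) c∈Y₁⊕Y₂
                                       (independent-⊆ Y₁⊕Y₂-c⊆B∪d B∪d-indep)
                                       (∪-mono B⊆W ⊆-refl ∘ Y₁⊕Y₂-c⊆B∪d) ⟩
      r (W ∪ ⁅ d ⁆)                ≤⟨ ρ-∪⁅⁆≤1+ρ W d ⟩
      suc (r W)                    ∎
      where
      open ≤-Reasoning
      c∈Y₁⊕Y₂ : c ∈ Y₁ ⊕ Y₂
      c∈Y₁⊕Y₂ = x∈p⊕q⁺ˡ Y₁ Y₂ c∈Y₁ λ c∈Y₂ →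
        [ ∁W∖A₀⇒∉B∪A₀ c∈∁W c∉A₀ , (λ c∈⁅d⁆ → c≢d (x∈⁅y⁆⇒x≡y d c∈⁅d⁆)) ] (x∈p∪q⁻ (B ∪ A₀) ⁅ d ⁆ (Y₂⊆ c∈Y₂))
      Y₁⊕Y₂-c⊆B∪d : Y₁ ⊕ Y₂ - c ⊆ B ∪ ⁅ d ⁆
      Y₁⊕Y₂-c⊆B∪d = ⊕-fundamental⊆ Y₁⊆ Y₂⊆ A₀⊆Y₁ A₀⊆Y₂
      B∪d-indep : Independent (B ∪ ⁅ d ⁆)
      B∪d-indep = basis-∪-independent B⊆W B-indep ∣B∣≡rW (x∈p⇒⁅x⁆⊆p d∈∁W) (begin
        r W + ∣ ⁅ d ⁆ ∣ ≡⟨ cong (r W +_) (∣⁅x⁆∣≡1 d) ⟩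
        r W + 1         ≡⟨ +-comm (r W) 1 ⟩
        suc (r W)       ≤⟨ flat-∉⇒ρ<ρ∪⁅⁆ (proj₁ (proj₁ W-proper)) (x∈∁p⇒x∉p d∈∁W) ⟩
        r (W ∪ ⁅ d ⁆)   ∎)
      W∪cd⊆ : W ∪ (⁅ c ⁆ ∪ ⁅ d ⁆) ⊆ (W ∪ ⁅ d ⁆) ∪ (Y₁ ⊕ Y₂)
      W∪cd⊆ = ∪-lub (p⊆p∪q (Y₁ ⊕ Y₂) ∘ p⊆p∪q ⁅ d ⁆)
                    (∪-lub (q⊆p∪q _ (Y₁ ⊕ Y₂) ∘ x∈p⇒⁅x⁆⊆p c∈Y₁⊕Y₂) (p⊆p∪q (Y₁ ⊕ Y₂) ∘ q⊆p∪q W ⁅ d ⁆))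

  private
    rW+corank≡r⊤ : ∀ {W} → Proper W → r W + (r ⊤ ∸ r W) ≡ r ⊤
    rW+corank≡r⊤ W-proper = m+[n∸m]≡n (<⇒≤ (proper-ρ<ρ⊤ W-proper))

    corank+2≤∣∁∣ : ∀ {W} → Proper W → 2 + r ⊤ ≤ r W + ∣ ∁ W ∣ → r ⊤ ∸ r W + 2 ≤ ∣ ∁ W ∣
    corank+2≤∣∁∣ {W} W-proper room = +-cancelˡ-≤ (r W) _ _ (begin
      r W + (r ⊤ ∸ r W + 2) ≡⟨ sym (+-assoc (r W) _ 2) ⟩
      r W + (r ⊤ ∸ r W) + 2 ≡⟨ cong (_+ 2) (rW+corank≡r⊤ W-proper) ⟩
      r ⊤ + 2               ≡⟨ +-comm (r ⊤) 2 ⟩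
      2 + r ⊤               ≤⟨ room ⟩
      r W + ∣ ∁ W ∣         ∎)
      where open ≤-Reasoning

  proper-ρ⊤≤1+ρ : ∀ {W} → Proper W → 2 + r ⊤ ≤ r W + ∣ ∁ W ∣ → r ⊤ ≤ suc (r W)
  proper-ρ⊤≤1+ρ {W} W-proper room with r ⊤ ≤? suc (r W)
  ... | yes r⊤≤1+rW = r⊤≤1+rW
  ... | no r⊤≰1+rW
    with basis W | subset-of-size (∁ W) (r ⊤ ∸ r W) (≤-trans (m≤m+n _ 2) (corank+2≤∣∁∣ W-proper room))
  ... | B , B⊆W , B-indep , ∣B∣≡rW | A₀ , A₀⊆∁W , ∣A₀∣≡corank
    with two-distinct (∁ W ─ A₀) (+-cancelˡ-≤ ∣ A₀ ∣ 2 _ (begin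
      ∣ A₀ ∣ + 2               ≡⟨ cong (_+ 2) ∣A₀∣≡corank ⟩
      r ⊤ ∸ r W + 2            ≤⟨ corank+2≤∣∁∣ W-proper room ⟩
      ∣ ∁ W ∣                  ≡⟨ p⊆q⇒∣q∣≡∣p∣+∣q─p∣ A₀⊆∁W ⟩
      ∣ A₀ ∣ + ∣ ∁ W ─ A₀ ∣    ∎))
    where open ≤-Reasoning
  ... | c , d , c∈∁W─A₀ , d∈∁W─A₀ , c≢d with x∈p─q⁻ (∁ W) A₀ c∈∁W─A₀ | x∈p─q⁻ (∁ W) A₀ d∈∁W─A₀
  ...   | c∈∁W , c∉A₀ | d∈∁W , d∉A₀ = ⊥-elim (<-irrefl refl (begin-strict
    suc (r W)               <⟨ n<1+n _ ⟩
    2 + r W                 ≡⟨ +-comm 2 (r W) ⟩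
    r W + 2                 ≡⟨ cong (r W +_) (sym (∣⁅x⁆∪⁅y⁆∣≡2 c≢d)) ⟩
    r W + ∣ ⁅ c ⁆ ∪ ⁅ d ⁆ ∣ ≤⟨ proper-∪-independent W-proper cd⊆∁W rW+2≤r⊤ ⟩
    r (W ∪ (⁅ c ⁆ ∪ ⁅ d ⁆)) ≤⟨ outside-pair-spanned W-proper B⊆W B-indep ∣B∣≡rW A₀⊆∁W rW+∣A₀∣≡r⊤
                                                    c∈∁W d∈∁W c∉A₀ d∉A₀ c≢d ⟩
    suc (r W)               ∎))
    where
    open ≤-Reasoning
    rW+∣A₀∣≡r⊤ : r W + ∣ A₀ ∣ ≡ r ⊤
    rW+∣A₀∣≡r⊤ = trans (cong (r W +_) ∣A₀∣≡corank) (rW+corank≡r⊤ W-proper)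
    cd⊆∁W : ⁅ c ⁆ ∪ ⁅ d ⁆ ⊆ ∁ W
    cd⊆∁W = ∪-lub (x∈p⇒⁅x⁆⊆p c∈∁W) (x∈p⇒⁅x⁆⊆p d∈∁W)
    rW+2≤r⊤ : r W + ∣ ⁅ c ⁆ ∪ ⁅ d ⁆ ∣ ≤ r ⊤
    rW+2≤r⊤ = begin
      r W + ∣ ⁅ c ⁆ ∪ ⁅ d ⁆ ∣ ≡⟨ cong (r W +_) (∣⁅x⁆∪⁅y⁆∣≡2 c≢d) ⟩
      r W + 2                 ≡⟨ +-comm (r W) 2 ⟩
      2 + r W                 ≤⟨ ≰⇒> r⊤≰1+rW ⟩
      r ⊤                     ∎

  module _ (3+ρ⊤≤n : 3 + r ⊤ ≤ n) where

    proper-hyperplane : ∀ {W} → Proper W → r ⊤ ≤ suc (r W)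
    proper-hyperplane {W} W-proper = proper-ρ⊤≤1+ρ W-proper (≤-pred (begin
      3 + r ⊤               ≤⟨ 3+ρ⊤≤n ⟩
      n                     ≡⟨ sym (∣p∣+∣∁p∣≡n W) ⟩
      ∣ W ∣ + ∣ ∁ W ∣       ≤⟨ +-monoˡ-≤ _ (proper-∣∣≤1+ρ W-proper) ⟩
      suc (r W) + ∣ ∁ W ∣   ∎))
      where open ≤-Reasoning

    dependent-ρ⊤≤1+ρ : ∀ {A} → Dependent A → r ⊤ ≤ suc (r A)
    dependent-ρ⊤≤1+ρ {A} A-dependent with dependent⇒spanning⊎proper A-dependent
    ... | inj₁ r⊤≤rA = ≤-trans r⊤≤rA (n≤1+n (r A))
    ... | inj₂ (W , W-proper , rW≤rA) = ≤-trans (proper-hyperplane W-proper) (s≤s rW≤rA)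

    zeroSum-ρ⊤≤∣∣ : ∀ {Y} → Nonempty Y → ZeroSum Y → r ⊤ ≤ ∣ Y ∣
    zeroSum-ρ⊤≤∣∣ Y-nonempty ΣY≡0 =
      let Y-dependent = zeroSum⇒dependent Y-nonempty ΣY≡0
      in ≤-trans (dependent-ρ⊤≤1+ρ Y-dependent) Y-dependent

    zeroSum-pair-ρ⊤≤ : ∀ {Y Y₀} → Nonempty Y → ZeroSum Y → ZeroSum Y₀ → Nonempty (Y ⊕ Y₀) →
                       ∣ Y₀ ∣ ≤ r ⊤ →
                       r ⊤ ≤ ∣ Y ─ Y₀ ∣ + ∣ Y ─ Y₀ ∣
    zeroSum-pair-ρ⊤≤ {Y} {Y₀} Y-nonempty ΣY≡0 ΣY₀≡0 Y⊕Y₀-nonempty ∣Y₀∣≤r⊤ =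
      ≤-double-count {a = ∣ Y ∩ Y₀ ∣} {c = ∣ Y₀ ─ Y ∣}
        (≤-trans (zeroSum-ρ⊤≤∣∣ Y-nonempty ΣY≡0) (≤-reflexive (∣p∣≡∣p∩q∣+∣p─q∣ Y Y₀)))
        (≤-trans (zeroSum-ρ⊤≤∣∣ Y⊕Y₀-nonempty (zeroSum-⊕ ΣY≡0 ΣY₀≡0))
                 (≤-reflexive (∣p⊕q∣≡∣p─q∣+∣q─p∣ Y Y₀)))
        (begin
          ∣ Y ∩ Y₀ ∣ + ∣ Y₀ ─ Y ∣ ≡⟨ cong (λ I → ∣ I ∣ + ∣ Y₀ ─ Y ∣) (∩-comm Y Y₀) ⟩
          ∣ Y₀ ∩ Y ∣ + ∣ Y₀ ─ Y ∣ ≡⟨ sym (∣p∣≡∣p∩q∣+∣p─q∣ Y₀ Y) ⟩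
          ∣ Y₀ ∣                  ≤⟨ ∣Y₀∣≤r⊤ ⟩
          r ⊤                     ∎)
      where open ≤-Reasoning

    ρ⊤≤4 : r ⊤ ≤ 4
    ρ⊤≤4 with proper-exists
    ... | W , W-proper with basis W | subset-of-size (∁ W) 2 (proper-2≤∣∁∣ W-proper)
    ... | B , B⊆W , B-indep , ∣B∣≡rW | P , P⊆∁W , ∣P∣≡2
      with dependent∖basis-nonempty (proper-dependent W-proper) ∣B∣≡rW
    ... | z , z∈W─B with x∈p─q⁻ W B z∈W─B | dependent⇒zeroSum⊆ {B ∪ P} (begin-strict
        r (B ∪ P)     ≤⟨ ρ-monotone ⊆⊤ ⟩
        r ⊤           ≤⟨ proper-hyperplane W-proper ⟩
        suc (r W)     <⟨ n<1+n _ ⟩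
        2 + r W       ≡⟨ +-comm 2 (r W) ⟩
        r W + 2       ≡⟨ cong₂ _+_ (sym ∣B∣≡rW) (sym ∣P∣≡2) ⟩
        ∣ B ∣ + ∣ P ∣ ≡⟨ sym (∣p∪q∣≡∣p∣+∣q∣ B P (p⊆q∧s⊆∁q⇒Disjoint B⊆W P⊆∁W)) ⟩
        ∣ B ∪ P ∣     ∎)
      where open ≤-Reasoning
    ... | z∈W , z∉B | Y , Y⊆B∪P , Y-nonempty , ΣY≡0 = begin
      r ⊤                           ≤⟨ zeroSum-pair-ρ⊤≤ Y-nonempty ΣY≡0 ΣY₀≡0 (z , z∈Y⊕Y₀) ∣Y₀∣≤r⊤ ⟩
      ∣ Y ─ Y₀ ∣ + ∣ Y ─ Y₀ ∣       ≤⟨ +-mono-≤ ∣Y─Y₀∣≤2 ∣Y─Y₀∣≤2 ⟩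
      4                             ∎
      where
      open ≤-Reasoning
      Y₀ : Subset n
      Y₀ = B ∪ ⁅ z ⁆
      ΣY₀≡0 : ZeroSum Y₀
      ΣY₀≡0 = proper-fundamental W-proper B⊆W ∣B∣≡rW z∈W z∉B
      ∣Y₀∣≤r⊤ : ∣ Y₀ ∣ ≤ r ⊤
      ∣Y₀∣≤r⊤ = begin
        ∣ B ∪ ⁅ z ⁆ ∣ ≡⟨ ∣p∪⁅x⁆∣≡1+∣p∣ B z∉B ⟩
        suc ∣ B ∣     ≡⟨ cong suc ∣B∣≡rW ⟩
        suc (r W)     ≤⟨ proper-ρ<ρ⊤ W-proper ⟩
        r ⊤           ∎
      z∈Y⊕Y₀ : z ∈ Y ⊕ Y₀
      z∈Y⊕Y₀ = x∈p⊕q⁺ʳ Y Y₀ z∉Y (q⊆p∪q B ⁅ z ⁆ (x∈⁅x⁆ z))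
        where
        z∉Y : z ∉ Y
        z∉Y z∈Y with x∈p∪q⁻ B P (Y⊆B∪P z∈Y)
        ... | inj₁ z∈B = z∉B z∈B
        ... | inj₂ z∈P = x∈∁p⇒x∉p (P⊆∁W z∈P) z∈W
      Y─Y₀⊆P : Y ─ Y₀ ⊆ P
      Y─Y₀⊆P y∈Y─Y₀ with x∈p─q⁻ Y Y₀ y∈Y─Y₀
      ... | y∈Y , y∉Y₀ with x∈p∪q⁻ B P (Y⊆B∪P y∈Y)
      ...   | inj₁ y∈B = ⊥-elim (y∉Y₀ (p⊆p∪q ⁅ z ⁆ y∈B))
      ...   | inj₂ y∈P = y∈P
      ∣Y─Y₀∣≤2 : ∣ Y ─ Y₀ ∣ ≤ 2
      ∣Y─Y₀∣≤2 = ≤-trans (p⊆q⇒∣p∣≤∣q∣ Y─Y₀⊆P) (≤-reflexive ∣P∣≡2)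

  n≡2+ρ⊤ : 5 ≤ r ⊤ → n ≡ 2 + r ⊤
  n≡2+ρ⊤ 5≤r⊤ = ≤-antisym (≮⇒≥ λ 3+r⊤≤n → <⇒≱ 5≤r⊤ (ρ⊤≤4 3+r⊤≤n)) 2+ρ⊤≤n

proposition8p6 : ∀ (n k d : ℕ) (M : Matroid n) →
    Binary M → Simple M → NoIsthmus M → IsNKD M k d →
    Height3 M → 5 ≤ k →
    η M ⊤ ≡ 2 × d ≡ 2
proposition8p6 n k d M (_ , v , represents) simple noIsthmus (ρ⊤≡k , minDistance) height3 5≤k =
  η⊤≡2 , n≤2+ρ⊤⇒minDistance≡2 (≤-reflexive n≡2+r⊤) minDistance
  where
  open Rank M
  open Height3Structure M (proj₁ simple) noIsthmus height3
  open BinaryHeight3 M v represents simple noIsthmus height3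
  n≡2+r⊤ : n ≡ 2 + r ⊤
  n≡2+r⊤ = n≡2+ρ⊤ (subst (5 ≤_) (sym ρ⊤≡k) 5≤k)
  η⊤≡2 : η M ⊤ ≡ 2
  η⊤≡2 = begin
    ∣ ⊤ {n} ∣ ∸ r ⊤ ≡⟨ cong (_∸ r ⊤) (trans (∣⊤∣≡n n) n≡2+r⊤) ⟩
    2 + r ⊤ ∸ r ⊤   ≡⟨ m+n∸n≡m 2 (r ⊤) ⟩
    2               ∎
    where open ≡-Reasoning
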